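{- Let $n\ge 1$, let $e_1,\dots,e_n$ be the standard basis of $\mathbb R^n$, and consider the following root systems and simple systems: (A) $\Phi=\{\pm(e_i-e_j):1\le i<j\le n\}$, $\Delta=\{e_{i+1}-e_i: i\in[n-1]\}$; (B) $\Phi=\{\pm(e_i\pm e_j):1\le i<j\le n\}\cup\{\pm e_i: i\in[n]\}$, $\Delta=\{e_{i+1}-e_i:i\in[n-1]\}\cup\{e_1\}$; (C) $\Phi=\{\pm(e_i\pm e_j):1\le i<j\le n\}\cup\{\pm 2e_i: i\in[n]\}$, $\Delta=\{e_{i+1}-e_i:i\in[n-1]\}\cup\{2e_1\}$; (D) $\Phi=\{\pm(e_i\pm e_j):1\le i<j\le n\}$, $\Delta=\{e_{i+1}-e_i:i\in[n-1]\}\cup\{e_1+e_2\}$. Then for every $\sigma$ in the Weyl group of $\Phi$, \[ L_{\Phi(\Delta)}(\sigma)=\begin{cases} \mathrm{oinv}(\sigma) & \text{in type } A,\\ \mathrm{oneg}(\sigma)+\mathrm{oinv}(\sigma)+\mathrm{onsp}(\sigma) & \text{in type } B,\\ \mathrm{nneg}(\sigma)+\mathrm{oinv}(\sigma)+\mathrm{ensp}(\sigma) & \text{in type } C,\\ \mathrm{oinv}(\sigma)+\mathrm{onsp}(\sigma) & \text{in type } D. \end{cases} \]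
   Context: Weyl group elements are identified with (signed) permutations: a signed permutation $\sigma$ of $[n]$ is a bijection of $[\pm n]=\{\pm1,\dots,\pm n\}$ with $\sigma(-i)=-\sigma(i)$, written in window notation $[\sigma(1),\dots,\sigma(n)]$, acting on $\mathbb R^n$ by $\sigma(e_i)=e_{\sigma(i)}$ where $e_{ -k}:=-e_k$. The Weyl group of type $A$ is the symmetric group $S_n$, of types $B$ and $C$ the group $B_n$ of all signed permutations, of type $D$ the group $D_n$ of signed permutations with an even number of negative entries in the window. For a root $\alpha=\sum_{\beta\in\Delta}c_\beta\beta$, $\mathrm{ht}_\Delta(\alpha)=\sum c_\beta$; positive roots are those with nonnegative coefficients, negative roots their negatives; $L_{\Phi(\Delta)}(\sigma)$ is the number of positive roots $\alpha$ of odd height such that $\sigma(\alpha)$ is a negative root. Statistics on window notation: $\mathrm{nneg}(\sigma)=|\{i\in[n]:\sigma(i)<0\}|$; $\mathrm{oneg}(\sigma)=|\{i\in[n]:\sigma(i)<0,\ i\text{ odd}\}|$; $\mathrm{oinv}(\sigma)=|\{(i,j):1\le i<j\le n,\ \sigma(i)>\sigma(j),\ j-i\text{ odd}\}|$; $\mathrm{onsp}(\sigma)=|\{(i,j):1\le i<j\le n,\ \sigma(i)+\sigma(j)<0,\ j-i\text{ odd}\}|$; $\mathrm{ensp}(\sigma)=|\{(i,j):1\le i<j\le n,\ \sigma(i)+\sigma(j)<0,\ j-i\text{ even}\}|$. -}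

module Defs where

open import Data.Bool using (Bool; true; false; if_then_else_; _∧_)
open import Data.Nat as ℕ using (ℕ; zero; suc; _∸_; _%_; _≡ᵇ_; _<ᵇ_)
open import Data.Integer as ℤ using (ℤ; +_; -[1+_]; _+_; _*_; -_; ∣_∣; _-_)
open import Data.Integer.Properties using (_<?_; _≟_)
open import Data.Fin as Fin using (Fin; toℕ; inject₁)
import Data.Fin.Properties as FinP
open import Data.Vec as Vec using (Vec; zipWith; replicate; tabulate)
open import Data.List as List using (List; []; _∷_; _++_; length; concatMap; filterᵇ; allFin; foldr)
open import Data.List.Membership.Propositional using (_∈_)
open import Data.List.Relation.Unary.Unique.Propositional using (Unique)
open import Data.Product using (Σ; _×_; _,_)
open import Relation.Nullary.Decidable using (does)
open import Relation.Binary.PropositionalEquality using (_≡_)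
open import Function.Definitions using (Injective)

-- Vectors in ℤ^n (the roots all have integer coordinates)

V : ℕ → Set
V n = Vec ℤ n

_⊕_ : ∀ {n} → V n → V n → V n
_⊕_ = zipWith _+_

_⊖_ : ∀ {n} → V n → V n → V n
_⊖_ = zipWith _-_

negV : ∀ {n} → V n → V n
negV = Vec.map (λ x → - x)

scale : ∀ {n} → ℤ → V n → V n
scale k = Vec.map (k *_)

0V : ∀ {n} → V n
0V = replicate _ (+ 0)

sumV : ∀ {n} → List (V n) → V n
sumV = foldr _⊕_ 0V

-- standard basis vector e_{i+1} (0-based index i)
e : ∀ {n} → Fin n → V n
e i = tabulate (λ j → if does (i FinP.≟ j) then + 1 else + 0)

-- Signed permutations of [n]: σ(i+1) = ±(perm i + 1), sign negative iff neg i

record SignedPerm (n : ℕ) : Set where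
  field
    perm : Fin n → Fin n
    perm-inj : Injective _≡_ _≡_ perm
    neg : Fin n → Bool

open SignedPerm public

-- window notation: window σ i = σ(i+1)
window : ∀ {n} → SignedPerm n → Fin n → ℤ
window σ i = if neg σ i then -[1+ toℕ (perm σ i) ] else + suc (toℕ (perm σ i))

sgn : ∀ {n} → SignedPerm n → Fin n → ℤ
sgn σ i = if neg σ i then -[1+ 0 ] else + 1

-- linear action: σ(e_i) = e_{σ(i)} with e_{-k} = -e_k, extended linearly
act : ∀ {n} → SignedPerm n → V n → V n
act {n} σ v = sumV (List.map (λ i → scale (sgn σ i * Vec.lookup v i) (e (perm σ i))) (allFin n))

-- Counting and window statistics (positions are 1-based in the paper:
-- paper position p = toℕ i + 1)

count : {A : Set} → (A → Bool) → List A → ℕ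
count p xs = length (filterᵇ p xs)

pairs : (n : ℕ) → List (Fin n × Fin n)
pairs n = concatMap (λ i → concatMap (λ j → if toℕ i <ᵇ toℕ j then (i , j) ∷ [] else []) (allFin n)) (allFin n)

oddℕ : ℕ → Bool
oddℕ k = k % 2 ≡ᵇ 1

evenℕ : ℕ → Bool
evenℕ k = k % 2 ≡ᵇ 0

isNeg : ℤ → Bool
isNeg x = does (x <? + 0)

nneg : ∀ {n} → SignedPerm n → ℕ
nneg {n} σ = count (λ i → isNeg (window σ i)) (allFin n)

-- paper position toℕ i + 1 is odd iff toℕ i is even
oneg : ∀ {n} → SignedPerm n → ℕ
oneg {n} σ = count (λ i → isNeg (window σ i) ∧ evenℕ (toℕ i)) (allFin n)

oinv : ∀ {n} → SignedPerm n → ℕ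
oinv {n} σ = count (λ { (i , j) → does (window σ j <? window σ i) ∧ oddℕ (toℕ j ∸ toℕ i) }) (pairs n)

onsp : ∀ {n} → SignedPerm n → ℕ
onsp {n} σ = count (λ { (i , j) → isNeg (window σ i + window σ j) ∧ oddℕ (toℕ j ∸ toℕ i) }) (pairs n)

ensp : ∀ {n} → SignedPerm n → ℕ
ensp {n} σ = count (λ { (i , j) → isNeg (window σ i + window σ j) ∧ evenℕ (toℕ j ∸ toℕ i) }) (pairs n)

-- Weyl groups as sets of signed permutations

InS : ∀ {n} → SignedPerm n → Set
InS {n} σ = (i : Fin n) → neg σ i ≡ false

InD : ∀ {n} → SignedPerm n → Set
InD σ = nneg σ % 2 ≡ 0

pm : ∀ {n} → V n → List (V n)
pm v = v ∷ negV v ∷ []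

rootsA : (n : ℕ) → List (V n)
rootsA n = concatMap (λ { (i , j) → pm (e i ⊖ e j) }) (pairs n)

rootsPlus : (n : ℕ) → List (V n)
rootsPlus n = concatMap (λ { (i , j) → pm (e i ⊕ e j) }) (pairs n)

ΦA ΦB ΦC ΦD : (n : ℕ) → List (V n)
ΦA n = rootsA n
ΦB n = rootsA n ++ rootsPlus n ++ concatMap (λ i → pm (e i)) (allFin n)
ΦC n = rootsA n ++ rootsPlus n ++ concatMap (λ i → pm (scale (+ 2) (e i))) (allFin n)
ΦD n = rootsA n ++ rootsPlus n

ΔA ΔB ΔC ΔD : (n : ℕ) → List (V n)
ΔA zero = []
ΔA (suc k) = List.map (λ i → e (Fin.suc i) ⊖ e (inject₁ i)) (allFin k)
ΔB zero = []
ΔB (suc k) = ΔA (suc k) ++ e Fin.zero ∷ []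
ΔC zero = []
ΔC (suc k) = ΔA (suc k) ++ scale (+ 2) (e Fin.zero) ∷ []
ΔD zero = []
ΔD (suc zero) = []   -- n = 1: Φ_D is empty, so Δ is empty
ΔD (suc (suc k)) = ΔA (suc (suc k)) ++ (e Fin.zero ⊕ e (Fin.suc Fin.zero)) ∷ []

combo : ∀ {n} → (Δ : List (V n)) → (Fin (length Δ) → ℤ) → V n
combo Δ c = sumV (List.map (λ j → scale (c j) (List.lookup Δ j)) (allFin (length Δ)))

sumC : ∀ {m} → (Fin m → ℤ) → ℤ
sumC {m} c = foldr _+_ (+ 0) (List.map c (allFin m))

IsPositiveRoot : ∀ {n} → List (V n) → List (V n) → V n → Set
IsPositiveRoot Φ Δ α =
  α ∈ Φ × Σ (Fin (length Δ) → ℤ) (λ c → combo Δ c ≡ α × ((j : Fin (length Δ)) → + 0 ℤ.≤ c j))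

IsNegativeRoot : ∀ {n} → List (V n) → List (V n) → V n → Set
IsNegativeRoot {n} Φ Δ β = Σ (V n) (λ α → IsPositiveRoot Φ Δ α × β ≡ negV α)

HasOddHeight : ∀ {n} → List (V n) → V n → Set
HasOddHeight Δ α = Σ (Fin (length Δ) → ℤ) (λ c → combo Δ c ≡ α × ∣ sumC c ∣ % 2 ≡ 1)

-- the predicate counted by L_{Φ(Δ)}(σ)
LPred : ∀ {n} → List (V n) → List (V n) → SignedPerm n → V n → Set
LPred Φ Δ σ α = IsPositiveRoot Φ Δ α × HasOddHeight Δ α × IsNegativeRoot Φ Δ (act σ α)

HasCard : ∀ {n} → (V n → Set) → ℕ → Set
HasCard {n} P k =
  Σ (List (V n)) (λ l → Unique l × ((α : V n) → (α ∈ l → P α) × (P α → α ∈ l)) × length l ≡ k)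

L≡ : ∀ {n} → List (V n) → List (V n) → SignedPerm n → ℕ → Set
L≡ Φ Δ σ k = HasCard (LPred Φ Δ σ) k

module Submission where

-- The proof
-- uses two linear forms on ℤⁿ.  The form ρ(e_m) = m is positive on every
-- positive root and negative on every negative one, and ρ(σ(e_i)) is the window
-- entry σ(i); so "σ(α) is negative" becomes a sign condition on window entries.
-- An affine form e_m ↦ K·m + B taking the constant value K on the simple roots is
-- K times the height on the cone of Δ, so it decides the parity of heights.
--
-- The positive roots of
-- every type are the shapes e_j − e_i, e_i + e_j (i < j), e_i or 2e_i; the module
-- RootData turns the two forms into a criterion "counted ⇔ statistic holds" for
-- each shape, and each type is the disjoint union of its shape families, whose
-- counts are exactly the statistics of the window of σ.  Comments index
-- positions from 1 as in the paper (e_1 is e Fin.zero).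

open import Defs

open import Data.Bool using (Bool; true; false; if_then_else_; T; T?; not; _∧_)
open import Data.Bool.Properties using (T-∧)
open import Data.Nat as ℕ using (ℕ; zero; suc; _∸_; _%_; _<ᵇ_; z≤n; s≤s)
import Data.Nat.Properties as ℕP
open import Data.Nat.DivMod using ([m+kn]%n≡m%n)
import Data.Nat.Tactic.RingSolver as ℕ-Solver
open import Data.Integer as ℤ using (ℤ; +_; -[1+_]; _+_; _*_; -_; _-_; ∣_∣; +≤+; +<+)
import Data.Integer.Properties as ℤP
open import Data.Integer.Properties using (_<?_)
open import Data.Integer.Tactic.RingSolver using (solve-∀)
open import Data.Fin as Fin using (Fin; toℕ; inject₁)
import Data.Fin.Properties as FinP
open import Data.Vec as Vec using ([]; _∷_; lookup)
import Data.Vec.Properties as VecP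
open import Data.List as List using (List; []; _∷_; _++_; length; concatMap; allFin; filterᵇ; foldr)
import Data.List.Properties as ListP
open import Data.List.Membership.Propositional using (_∈_; find; lose)
import Data.List.Membership.Propositional.Properties as ∈P
import Data.List.Relation.Unary.Any as Any
open import Data.List.Relation.Unary.Any using (here; there)
import Data.List.Relation.Unary.Any.Properties as AnyP
import Data.List.Relation.Unary.All as All
import Data.List.Relation.Unary.All.Properties as AllP
import Data.List.Relation.Unary.AllPairs as AllPairs
import Data.List.Relation.Unary.AllPairs.Properties as AllPairsP
open import Data.List.Relation.Unary.Unique.Propositional using (Unique)
import Data.List.Relation.Unary.Unique.Propositional.Properties as UniqueP
open import Data.Product using (Σ; ∃-syntax; _×_; _,_; proj₁; proj₂)
open import Data.Product.Function.NonDependent.Propositional using (_×-⇔_)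
open import Data.Sum using (_⊎_; inj₁; inj₂; [_,_])
open import Data.Empty using (⊥)
open import Data.Unit using (tt)
open import Function using (_∘_; _⇔_; mk⇔; Equivalence)
import Function.Properties.Equivalence as ⇔
open import Relation.Nullary using (Dec; does; yes; no; contradiction)
open import Relation.Binary.Definitions using (tri<; tri≈; tri>)
open import Relation.Binary.PropositionalEquality using (_≡_; _≢_; refl; sym; trans; cong; cong₂; subst; subst₂; module ≡-Reasoning)

S : {A : Set} → List A → (A → ℤ) → ℤ
S xs f = foldr _+_ (+ 0) (List.map f xs)

S-cong : {A : Set} (xs : List A) {f g : A → ℤ} → (∀ x → f x ≡ g x) → S xs f ≡ S xs g
S-cong [] eq = refl
S-cong (x ∷ xs) eq = cong₂ _+_ (eq x) (S-cong xs eq)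

S-map : {A B : Set} (xs : List A) (g : A → B) (f : B → ℤ) → S (List.map g xs) f ≡ S xs (f ∘ g)
S-map [] g f = refl
S-map (x ∷ xs) g f = cong (_+_ (f (g x))) (S-map xs g f)

S-*ˡ : {A : Set} (xs : List A) (k : ℤ) (f : A → ℤ) → S xs (λ x → k * f x) ≡ k * S xs f
S-*ˡ [] k f = sym (ℤP.*-zeroʳ k)
S-*ˡ (x ∷ xs) k f = trans (cong (_+_ (k * f x)) (S-*ˡ xs k f)) (sym (ℤP.*-distribˡ-+ k (f x) (S xs f)))

S-nonneg : {A : Set} (xs : List A) (f : A → ℤ) → (∀ x → + 0 ℤ.≤ f x) → + 0 ℤ.≤ S xs f
S-nonneg [] f p = ℤP.≤-refl
S-nonneg (x ∷ xs) f p = ℤP.+-mono-≤ (p x) (S-nonneg xs f p)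

⊕-comm : ∀ {n} (u v : V n) → u ⊕ v ≡ v ⊕ u
⊕-comm = VecP.zipWith-comm ℤP.+-comm

⊕-identityˡ : ∀ {n} (v : V n) → 0V ⊕ v ≡ v
⊕-identityˡ = VecP.zipWith-identityˡ ℤP.+-identityˡ

⊕-identityʳ : ∀ {n} (v : V n) → v ⊕ 0V ≡ v
⊕-identityʳ = VecP.zipWith-identityʳ ℤP.+-identityʳ

⊕-interchange : ∀ {n} (a b c d : V n) → (a ⊕ b) ⊕ (c ⊕ d) ≡ (a ⊕ c) ⊕ (b ⊕ d)
⊕-interchange [] [] [] [] = refl
⊕-interchange (a ∷ as) (b ∷ bs) (c ∷ cs) (d ∷ ds) = cong₂ _∷_ (ring a b c d) (⊕-interchange as bs cs ds)
  where ring : ∀ a b c d → (a + b) + (c + d) ≡ (a + c) + (b + d)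
        ring = solve-∀

scale-distribʳ : ∀ {n} (a b : ℤ) (v : V n) → scale (a + b) v ≡ scale a v ⊕ scale b v
scale-distribʳ a b [] = refl
scale-distribʳ a b (x ∷ v) = cong₂ _∷_ (ℤP.*-distribʳ-+ x a b) (scale-distribʳ a b v)

scale-⊕ : ∀ {n} (k : ℤ) (u v : V n) → scale k (u ⊕ v) ≡ scale k u ⊕ scale k v
scale-⊕ k [] [] = refl
scale-⊕ k (x ∷ u) (y ∷ v) = cong₂ _∷_ (ℤP.*-distribˡ-+ k x y) (scale-⊕ k u v)

scale-assoc : ∀ {n} (a b : ℤ) (v : V n) → scale a (scale b v) ≡ scale (a * b) v
scale-assoc a b [] = refl
scale-assoc a b (x ∷ v) = cong₂ _∷_ (sym (ℤP.*-assoc a b x)) (scale-assoc a b v)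

scale-zeroˡ : ∀ {n} (v : V n) → scale (+ 0) v ≡ 0V
scale-zeroˡ [] = refl
scale-zeroˡ (x ∷ v) = cong (+ 0 ∷_) (scale-zeroˡ v)

scale-zeroʳ : ∀ {n} (k : ℤ) → scale k (0V {n}) ≡ 0V
scale-zeroʳ {zero} k = refl
scale-zeroʳ {suc n} k = cong₂ _∷_ (ℤP.*-zeroʳ k) (scale-zeroʳ k)

scale-identity : ∀ {n} (v : V n) → scale (+ 1) v ≡ v
scale-identity [] = refl
scale-identity (x ∷ v) = cong₂ _∷_ (ℤP.*-identityˡ x) (scale-identity v)

negV-as-scale : ∀ {n} (v : V n) → negV v ≡ scale -[1+ 0 ] v
negV-as-scale [] = refl
negV-as-scale (x ∷ v) = cong₂ _∷_ (sym (ℤP.-1*i≡-i x)) (negV-as-scale v)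

negV-involutive : ∀ {n} (v : V n) → negV (negV v) ≡ v
negV-involutive [] = refl
negV-involutive (x ∷ v) = cong₂ _∷_ (ℤP.neg-involutive x) (negV-involutive v)

scale-negV : ∀ {n} (k : ℤ) (v : V n) → scale k (negV v) ≡ negV (scale k v)
scale-negV k [] = refl
scale-negV k (x ∷ v) = cong₂ _∷_ (sym (ℤP.neg-distribʳ-* k x)) (scale-negV k v)

negV-⊕ : ∀ {n} (u v : V n) → negV u ⊕ negV v ≡ negV (u ⊕ v)
negV-⊕ [] [] = refl
negV-⊕ (x ∷ u) (y ∷ v) = cong₂ _∷_ (sym (ℤP.neg-distrib-+ x y)) (negV-⊕ u v)

⊖-as-⊕ : ∀ {n} (u v : V n) → u ⊖ v ≡ u ⊕ negV v
⊖-as-⊕ [] [] = refl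
⊖-as-⊕ (x ∷ u) (y ∷ v) = cong (x - y ∷_) (⊖-as-⊕ u v)

negV-⊖ : ∀ {n} (u v : V n) → negV (u ⊖ v) ≡ v ⊖ u
negV-⊖ [] [] = refl
negV-⊖ (x ∷ u) (y ∷ v) = cong₂ _∷_ (ring x y) (negV-⊖ u v)
  where ring : ∀ x y → - (x - y) ≡ y - x
        ring = solve-∀

⊖-self : ∀ {n} (v : V n) → v ⊖ v ≡ 0V
⊖-self [] = refl
⊖-self (x ∷ v) = cong₂ _∷_ (ℤP.+-inverseʳ x) (⊖-self v)

⊖-chain : ∀ {n} (a b c : V n) → (a ⊖ b) ⊕ (b ⊖ c) ≡ a ⊖ c
⊖-chain [] [] [] = refl
⊖-chain (x ∷ a) (y ∷ b) (z ∷ c) = cong₂ _∷_ (ring x y z) (⊖-chain a b c)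
  where ring : ∀ x y z → (x - y) + (y - z) ≡ x - z
        ring = solve-∀

⊖-⊕-cancel : ∀ {n} (a b : V n) → (a ⊖ b) ⊕ b ≡ a
⊖-⊕-cancel [] [] = refl
⊖-⊕-cancel (x ∷ a) (y ∷ b) = cong₂ _∷_ (ring x y) (⊖-⊕-cancel a b)
  where ring : ∀ x y → (x - y) + y ≡ x
        ring = solve-∀

⟪_,_⟫ : ∀ {n} → (Fin n → ℤ) → V n → ℤ
⟪ w , [] ⟫ = + 0
⟪ w , x ∷ v ⟫ = w Fin.zero * x + ⟪ w ∘ Fin.suc , v ⟫

⟪⟫-⊕ : ∀ {n} (w : Fin n → ℤ) (u v : V n) → ⟪ w , u ⊕ v ⟫ ≡ ⟪ w , u ⟫ + ⟪ w , v ⟫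
⟪⟫-⊕ w [] [] = refl
⟪⟫-⊕ w (x ∷ u) (y ∷ v) rewrite ⟪⟫-⊕ (w ∘ Fin.suc) u v = ring (w Fin.zero) x y _ _
  where ring : ∀ a x y p q → a * (x + y) + (p + q) ≡ (a * x + p) + (a * y + q)
        ring = solve-∀

⟪⟫-⊖ : ∀ {n} (w : Fin n → ℤ) (u v : V n) → ⟪ w , u ⊖ v ⟫ ≡ ⟪ w , u ⟫ - ⟪ w , v ⟫
⟪⟫-⊖ w [] [] = refl
⟪⟫-⊖ w (x ∷ u) (y ∷ v) rewrite ⟪⟫-⊖ (w ∘ Fin.suc) u v = ring (w Fin.zero) x y _ _
  where ring : ∀ a x y p q → a * (x - y) + (p - q) ≡ (a * x + p) - (a * y + q)
        ring = solve-∀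

⟪⟫-scale : ∀ {n} (w : Fin n → ℤ) (k : ℤ) (v : V n) → ⟪ w , scale k v ⟫ ≡ k * ⟪ w , v ⟫
⟪⟫-scale w k [] = sym (ℤP.*-zeroʳ k)
⟪⟫-scale w k (x ∷ v) rewrite ⟪⟫-scale (w ∘ Fin.suc) k v = ring (w Fin.zero) k x _
  where ring : ∀ a k x p → a * (k * x) + k * p ≡ k * (a * x + p)
        ring = solve-∀

⟪⟫-negV : ∀ {n} (w : Fin n → ℤ) (v : V n) → ⟪ w , negV v ⟫ ≡ - ⟪ w , v ⟫
⟪⟫-negV w v = begin
  ⟪ w , negV v ⟫               ≡⟨ cong ⟪ w ,_⟫ (negV-as-scale v) ⟩
  ⟪ w , scale -[1+ 0 ] v ⟫     ≡⟨ ⟪⟫-scale w -[1+ 0 ] v ⟩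
  -[1+ 0 ] * ⟪ w , v ⟫         ≡⟨ ℤP.-1*i≡-i _ ⟩
  - ⟪ w , v ⟫                  ∎
  where open ≡-Reasoning

⟪⟫-negV-< : ∀ {n} (w : Fin n → ℤ) (v : V n) → + 0 ℤ.< ⟪ w , v ⟫ → ⟪ w , negV v ⟫ ℤ.< + 0
⟪⟫-negV-< w v w>0 = subst (ℤ._< + 0) (sym (⟪⟫-negV w v)) (ℤP.neg-mono-< w>0)

⟪⟫-negV-> : ∀ {n} (w : Fin n → ℤ) (v : V n) → ⟪ w , v ⟫ ℤ.< + 0 → + 0 ℤ.< ⟪ w , negV v ⟫
⟪⟫-negV-> w v w<0 = subst (+ 0 ℤ.<_) (sym (⟪⟫-negV w v)) (ℤP.neg-mono-< w<0)

⟪⟫-0V : ∀ {n} (w : Fin n → ℤ) → ⟪ w , 0V {n} ⟫ ≡ + 0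
⟪⟫-0V {zero} w = refl
⟪⟫-0V {suc n} w = cong₂ _+_ (ℤP.*-zeroʳ (w Fin.zero)) (⟪⟫-0V (w ∘ Fin.suc))

e-zero : ∀ {n} → e {suc n} Fin.zero ≡ + 1 ∷ 0V
e-zero = cong (+ 1 ∷_) (zeros _)
  where zeros : ∀ n → Vec.tabulate {n = n} (λ _ → + 0) ≡ 0V
        zeros zero = refl
        zeros (suc n) = cong (+ 0 ∷_) (zeros n)

⟪⟫-e : ∀ {n} (w : Fin n → ℤ) (i : Fin n) → ⟪ w , e i ⟫ ≡ w i
⟪⟫-e w Fin.zero = begin
  ⟪ w , e Fin.zero ⟫                          ≡⟨ cong ⟪ w ,_⟫ e-zero ⟩
  w Fin.zero * + 1 + ⟪ w ∘ Fin.suc , 0V ⟫     ≡⟨ cong₂ _+_ (ℤP.*-identityʳ (w Fin.zero)) (⟪⟫-0V (w ∘ Fin.suc)) ⟩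
  w Fin.zero + + 0                            ≡⟨ ℤP.+-identityʳ _ ⟩
  w Fin.zero                                  ∎
  where open ≡-Reasoning
⟪⟫-e w (Fin.suc i) =
  trans (cong (_+ ⟪ w ∘ Fin.suc , e i ⟫) (ℤP.*-zeroʳ (w Fin.zero))) (trans (ℤP.+-identityˡ _) (⟪⟫-e (w ∘ Fin.suc) i))

sumV-⊕ : ∀ {n} {A : Set} (xs : List A) (f g : A → V n) →
         sumV (List.map (λ x → f x ⊕ g x) xs) ≡ sumV (List.map f xs) ⊕ sumV (List.map g xs)
sumV-⊕ [] f g = sym (⊕-identityˡ 0V)
sumV-⊕ (x ∷ xs) f g = trans (cong ((f x ⊕ g x) ⊕_) (sumV-⊕ xs f g)) (⊕-interchange (f x) (g x) _ _)

sumV-scale : ∀ {n} {A : Set} (xs : List A) (k : ℤ) (f : A → V n) →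
             sumV (List.map (λ x → scale k (f x)) xs) ≡ scale k (sumV (List.map f xs))
sumV-scale [] k f = sym (scale-zeroʳ k)
sumV-scale (x ∷ xs) k f = trans (cong (scale k (f x) ⊕_) (sumV-scale xs k f)) (sym (scale-⊕ k (f x) _))

sumV-zero : ∀ {n} {A : Set} (xs : List A) (f : A → V n) → (∀ x → f x ≡ 0V) → sumV (List.map f xs) ≡ 0V
sumV-zero [] f z = refl
sumV-zero (x ∷ xs) f z rewrite z x | sumV-zero xs f z = ⊕-identityˡ 0V

map-allFin-suc : ∀ {m} {A : Set} (f : Fin (suc m) → A) →
                 List.map f (allFin (suc m)) ≡ f Fin.zero ∷ List.map (f ∘ Fin.suc) (allFin m)
map-allFin-suc f = cong (f Fin.zero ∷_) (trans (ListP.map-tabulate Fin.suc f) (sym (ListP.map-tabulate (λ i → i) (f ∘ Fin.suc))))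

sumV-single : ∀ {n m} (f : Fin m → V n) (j : Fin m) → (∀ i → i ≢ j → f i ≡ 0V) →
              sumV (List.map f (allFin m)) ≡ f j
sumV-single {m = suc m} f j z = trans (cong sumV (map-allFin-suc f)) (split j z)
  where
  split : (j : Fin (suc m)) → (∀ i → i ≢ j → f i ≡ 0V) →
          f Fin.zero ⊕ sumV (List.map (f ∘ Fin.suc) (allFin m)) ≡ f j
  split Fin.zero z =
    trans (cong (f Fin.zero ⊕_) (sumV-zero (allFin m) (f ∘ Fin.suc) (λ i → z (Fin.suc i) λ ()))) (⊕-identityʳ _)
  split (Fin.suc j) z rewrite z Fin.zero (λ ()) =
    trans (⊕-identityˡ _) (sumV-single (f ∘ Fin.suc) j (λ i i≢j → z (Fin.suc i) (i≢j ∘ FinP.suc-injective)))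

⟪⟫-sumV : ∀ {n} (w : Fin n → ℤ) (vs : List (V n)) → ⟪ w , sumV vs ⟫ ≡ S vs ⟪ w ,_⟫
⟪⟫-sumV w [] = ⟪⟫-0V w
⟪⟫-sumV w (v ∷ vs) = trans (⟪⟫-⊕ w v (sumV vs)) (cong (_+_ ⟪ w , v ⟫) (⟪⟫-sumV w vs))

⟪⟫-combo : ∀ {n} (w : Fin n → ℤ) (Δ : List (V n)) (c : Fin (length Δ) → ℤ) →
           ⟪ w , combo Δ c ⟫ ≡ S (allFin (length Δ)) (λ j → c j * ⟪ w , List.lookup Δ j ⟫)
⟪⟫-combo w Δ c = begin
  ⟪ w , sumV (List.map term (allFin (length Δ))) ⟫   ≡⟨ ⟪⟫-sumV w (List.map term (allFin (length Δ))) ⟩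
  S (List.map term (allFin (length Δ))) ⟪ w ,_⟫     ≡⟨ S-map (allFin (length Δ)) term ⟪ w ,_⟫ ⟩
  S (allFin (length Δ)) (⟪ w ,_⟫ ∘ term)            ≡⟨ S-cong (allFin (length Δ)) (λ j → ⟪⟫-scale w (c j) (List.lookup Δ j)) ⟩
  S (allFin (length Δ)) (λ j → c j * ⟪ w , List.lookup Δ j ⟫) ∎
  where open ≡-Reasoning
        term = λ j → scale (c j) (List.lookup Δ j)

combo-+ : ∀ {n} (Δ : List (V n)) (c₁ c₂ : Fin (length Δ) → ℤ) →
          combo Δ (λ j → c₁ j + c₂ j) ≡ combo Δ c₁ ⊕ combo Δ c₂
combo-+ Δ c₁ c₂ = trans (cong sumV (ListP.map-cong (λ j → scale-distribʳ (c₁ j) (c₂ j) (List.lookup Δ j)) (allFin (length Δ))))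
                        (sumV-⊕ (allFin (length Δ)) _ _)

combo-zero : ∀ {n} (Δ : List (V n)) → combo Δ (λ _ → + 0) ≡ 0V
combo-zero Δ = sumV-zero (allFin (length Δ)) _ (λ j → scale-zeroˡ (List.lookup Δ j))

δ : ∀ {m} → Fin m → Fin m → ℤ
δ j i = if does (j FinP.≟ i) then + 1 else + 0

δ-diag : ∀ {m} (j : Fin m) → δ j j ≡ + 1
δ-diag j with j FinP.≟ j
... | yes _ = refl
... | no j≢j = contradiction refl j≢j

δ-off : ∀ {m} {j i : Fin m} → i ≢ j → δ j i ≡ + 0
δ-off {j = j} {i} i≢j with j FinP.≟ i
... | yes j≡i = contradiction (sym j≡i) i≢j
... | no _ = refl

combo-δ : ∀ {n} (Δ : List (V n)) (j : Fin (length Δ)) → combo Δ (δ j) ≡ List.lookup Δ j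
combo-δ Δ j = trans (sumV-single term j (λ i i≢j → trans (cong (λ k → scale k (List.lookup Δ i)) (δ-off i≢j)) (scale-zeroˡ _)))
                    (trans (cong (λ k → scale k (List.lookup Δ j)) (δ-diag j)) (scale-identity _))
  where term = λ i → scale (δ j i) (List.lookup Δ i)

lookup-e : ∀ {n} (j i : Fin n) → lookup (e j) i ≡ δ j i
lookup-e j i = VecP.lookup∘tabulate _ i

E : ∀ {n} → Bool → Fin n → V n
E b p = if b then negV (e p) else e p

act-⊕ : ∀ {n} (σ : SignedPerm n) (u v : V n) → act σ (u ⊕ v) ≡ act σ u ⊕ act σ v
act-⊕ {n} σ u v = trans (cong sumV (ListP.map-cong term (allFin n))) (sumV-⊕ (allFin n) _ _)
  where
  term : ∀ i → scale (sgn σ i * lookup (u ⊕ v) i) (e (perm σ i))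
             ≡ scale (sgn σ i * lookup u i) (e (perm σ i)) ⊕ scale (sgn σ i * lookup v i) (e (perm σ i))
  term i rewrite VecP.lookup-zipWith _+_ i u v | ℤP.*-distribˡ-+ (sgn σ i) (lookup u i) (lookup v i) =
    scale-distribʳ (sgn σ i * lookup u i) (sgn σ i * lookup v i) (e (perm σ i))

act-scale : ∀ {n} (σ : SignedPerm n) (k : ℤ) (v : V n) → act σ (scale k v) ≡ scale k (act σ v)
act-scale {n} σ k v = trans (cong sumV (ListP.map-cong term (allFin n))) (sumV-scale (allFin n) k _)
  where
  term : ∀ i → scale (sgn σ i * lookup (scale k v) i) (e (perm σ i)) ≡ scale k (scale (sgn σ i * lookup v i) (e (perm σ i)))
  term i rewrite VecP.lookup-map i (k *_) v | scale-assoc k (sgn σ i * lookup v i) (e (perm σ i)) =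
    cong (λ c → scale c (e (perm σ i))) (ring (sgn σ i) k (lookup v i))
    where ring : ∀ s k x → s * (k * x) ≡ k * (s * x)
          ring = solve-∀

act-negV : ∀ {n} (σ : SignedPerm n) (v : V n) → act σ (negV v) ≡ negV (act σ v)
act-negV σ v = begin
  act σ (negV v)                 ≡⟨ cong (act σ) (negV-as-scale v) ⟩
  act σ (scale -[1+ 0 ] v)       ≡⟨ act-scale σ -[1+ 0 ] v ⟩
  scale -[1+ 0 ] (act σ v)       ≡⟨ sym (negV-as-scale (act σ v)) ⟩
  negV (act σ v)                 ∎
  where open ≡-Reasoning

act-⊖ : ∀ {n} (σ : SignedPerm n) (u v : V n) → act σ (u ⊖ v) ≡ act σ u ⊖ act σ v
act-⊖ σ u v = begin
  act σ (u ⊖ v)                  ≡⟨ cong (act σ) (⊖-as-⊕ u v) ⟩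
  act σ (u ⊕ negV v)             ≡⟨ act-⊕ σ u (negV v) ⟩
  act σ u ⊕ act σ (negV v)       ≡⟨ cong (act σ u ⊕_) (act-negV σ v) ⟩
  act σ u ⊕ negV (act σ v)       ≡⟨ sym (⊖-as-⊕ (act σ u) (act σ v)) ⟩
  act σ u ⊖ act σ v              ∎
  where open ≡-Reasoning

act-e : ∀ {n} (σ : SignedPerm n) (j : Fin n) → act σ (e j) ≡ E (neg σ j) (perm σ j)
act-e {n} σ j = trans (sumV-single term j off) (trans (cong (λ c → scale c (e (perm σ j))) (on-diag)) (signed (neg σ j)))
  where
  term = λ i → scale (sgn σ i * lookup (e j) i) (e (perm σ i))
  off : ∀ i → i ≢ j → term i ≡ 0V
  off i i≢j rewrite lookup-e j i | δ-off i≢j | ℤP.*-zeroʳ (sgn σ i) = scale-zeroˡ _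
  on-diag : sgn σ j * lookup (e j) j ≡ sgn σ j
  on-diag rewrite lookup-e j j | δ-diag j = ℤP.*-identityʳ _
  signed : ∀ b → scale (if b then -[1+ 0 ] else + 1) (e (perm σ j)) ≡ E b (perm σ j)
  signed true = sym (negV-as-scale _)
  signed false = scale-identity _

-- The form ρ(e_m) = m (toℕ m + 1 on a 0-based index).  It evaluates σ(e_i) to
-- the window entry σ(i).
ρ : ∀ {n} → Fin n → ℤ
ρ m = + suc (toℕ m)

ρ-E : ∀ {n} (b : Bool) (p : Fin n) → ⟪ ρ , E b p ⟫ ≡ (if b then -[1+ toℕ p ] else + suc (toℕ p))
ρ-E true p = trans (⟪⟫-negV ρ (e p)) (cong -_ (⟪⟫-e ρ p))
ρ-E false p = ⟪⟫-e ρ p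

ρ-act-e : ∀ {n} (σ : SignedPerm n) (i : Fin n) → ⟪ ρ , act σ (e i) ⟫ ≡ window σ i
ρ-act-e σ i = trans (cong ⟪ ρ ,_⟫ (act-e σ i)) (ρ-E (neg σ i) (perm σ i))

Cone : ∀ {n} → List (V n) → V n → Set
Cone Δ β = Σ (Fin (length Δ) → ℤ) (λ c → combo Δ c ≡ β × ((j : Fin (length Δ)) → + 0 ℤ.≤ c j))

cone-⊕ : ∀ {n} (Δ : List (V n)) {u v : V n} → Cone Δ u → Cone Δ v → Cone Δ (u ⊕ v)
cone-⊕ Δ (c₁ , refl , c₁≥0) (c₂ , refl , c₂≥0) =
  (λ j → c₁ j + c₂ j) , combo-+ Δ c₁ c₂ , (λ j → ℤP.+-mono-≤ (c₁≥0 j) (c₂≥0 j))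

cone-0V : ∀ {n} (Δ : List (V n)) → Cone Δ 0V
cone-0V Δ = (λ _ → + 0) , combo-zero Δ , (λ _ → ℤP.≤-refl)

cone-∈ : ∀ {n} (Δ : List (V n)) {β : V n} → β ∈ Δ → Cone Δ β
cone-∈ Δ β∈Δ = δ j , trans (combo-δ Δ j) (sym (AnyP.lookup-index β∈Δ)) , (λ i → indicator≥0 (does (j FinP.≟ i)))
  where
  j = Any.index β∈Δ
  indicator≥0 : ∀ b → + 0 ℤ.≤ (if b then + 1 else + 0)
  indicator≥0 true = +≤+ z≤n
  indicator≥0 false = +≤+ z≤n

HasSteps : ∀ {n} → List (V n) → Set
HasSteps {n} Δ = (i j : Fin n) → toℕ j ≡ suc (toℕ i) → e j ⊖ e i ∈ Δ

cone-steps : ∀ {n} (Δ : List (V n)) → HasSteps Δ → (d : ℕ) (i j : Fin n) → toℕ j ≡ d ℕ.+ toℕ i → Cone Δ (e j ⊖ e i)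
cone-steps Δ steps zero i j j≡i rewrite FinP.toℕ-injective {i = j} {j = i} j≡i =
  subst (Cone Δ) (sym (⊖-self (e i))) (cone-0V Δ)
cone-steps Δ steps (suc d) i (Fin.suc t) eq =
  subst (Cone Δ) (⊖-chain (e (Fin.suc t)) (e (inject₁ t)) (e i))
    (cone-⊕ Δ (cone-∈ Δ (steps (inject₁ t) (Fin.suc t) (cong suc (sym (FinP.toℕ-inject₁ t)))))
              (cone-steps Δ steps d i (inject₁ t) (trans (FinP.toℕ-inject₁ t) (ℕP.suc-injective eq))))

cone-diff : ∀ {n} (Δ : List (V n)) → HasSteps Δ → (i j : Fin n) → toℕ i ℕ.≤ toℕ j → Cone Δ (e j ⊖ e i)
cone-diff Δ steps i j i≤j = cone-steps Δ steps (toℕ j ℕ.∸ toℕ i) i j (sym (ℕP.m∸n+n≡m i≤j))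

*-nonneg : ∀ {a b} → + 0 ℤ.≤ a → + 0 ℤ.≤ b → + 0 ℤ.≤ a * b
*-nonneg {+ x} {+ y} _ _ = subst (+ 0 ℤ.≤_) (ℤP.pos-* x y) (+≤+ z≤n)

module Positivity {n} (Φ Δ : List (V n))
  (ρ-Δ : ∀ {β} → β ∈ Δ → + 0 ℤ.≤ ⟪ ρ , β ⟫)
  (split : ∀ {γ} → γ ∈ Φ → (Cone Δ γ × + 0 ℤ.< ⟪ ρ , γ ⟫) ⊎ ⟪ ρ , γ ⟫ ℤ.< + 0)
  (negV-closed : ∀ {γ} → γ ∈ Φ → negV γ ∈ Φ) where

  ρ-cone : ∀ {γ} → Cone Δ γ → + 0 ℤ.≤ ⟪ ρ , γ ⟫
  ρ-cone (c , refl , c≥0) = subst (+ 0 ℤ.≤_) (sym (⟪⟫-combo ρ Δ c))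
    (S-nonneg (allFin (length Δ)) _ (λ j → *-nonneg (c≥0 j) (ρ-Δ (∈P.∈-lookup j))))

  positive⇔ : ∀ {γ} → IsPositiveRoot Φ Δ γ ⇔ (γ ∈ Φ × + 0 ℤ.< ⟪ ρ , γ ⟫)
  positive⇔ = mk⇔ to from
    where
    to : ∀ {γ} → IsPositiveRoot Φ Δ γ → γ ∈ Φ × + 0 ℤ.< ⟪ ρ , γ ⟫
    to (γ∈Φ , cone) with split γ∈Φ
    ... | inj₁ (_ , ρ>0) = γ∈Φ , ρ>0
    ... | inj₂ ρ<0 = contradiction (ρ-cone cone) (ℤP.<⇒≱ ρ<0)
    from : ∀ {γ} → γ ∈ Φ × + 0 ℤ.< ⟪ ρ , γ ⟫ → IsPositiveRoot Φ Δ γ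
    from (γ∈Φ , ρ>0) with split γ∈Φ
    ... | inj₁ (cone , _) = γ∈Φ , cone
    ... | inj₂ ρ<0 = contradiction ρ>0 (ℤP.<-asym ρ<0)

  negative⇔ : ∀ {γ} → γ ∈ Φ → IsNegativeRoot Φ Δ γ ⇔ ⟪ ρ , γ ⟫ ℤ.< + 0
  negative⇔ {γ} γ∈Φ = mk⇔ to from
    where
    to : IsNegativeRoot Φ Δ γ → ⟪ ρ , γ ⟫ ℤ.< + 0
    to (α , α⁺ , refl) = ⟪⟫-negV-< ρ α (proj₂ (Equivalence.to positive⇔ α⁺))
    from : ⟪ ρ , γ ⟫ ℤ.< + 0 → IsNegativeRoot Φ Δ γ
    from ρ<0 = negV γ , Equivalence.from positive⇔ (negV-closed γ∈Φ , ⟪⟫-negV-> ρ γ ρ<0) , sym (negV-involutive γ)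

-- A form ht with the constant value K on Δ is K times the height on the cone of
-- Δ, so it determines the parity of the height of a positive root.
module Height {n} (Δ : List (V n)) (ht : Fin n → ℤ) (K : ℕ) .{{_ : ℕ.NonZero K}}
  (ht-Δ : ∀ {β} → β ∈ Δ → ⟪ ht , β ⟫ ≡ + K) where

  ht-combo : (c : Fin (length Δ) → ℤ) → ⟪ ht , combo Δ c ⟫ ≡ + K * sumC c
  ht-combo c = begin
    ⟪ ht , combo Δ c ⟫                                    ≡⟨ ⟪⟫-combo ht Δ c ⟩
    S (allFin (length Δ)) (λ j → c j * ⟪ ht , List.lookup Δ j ⟫)
                               ≡⟨ S-cong (allFin (length Δ)) (λ j → trans (cong (c j *_) (ht-Δ (∈P.∈-lookup j)))
                                                                            (ℤP.*-comm (c j) (+ K))) ⟩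
    S (allFin (length Δ)) (λ j → + K * c j)               ≡⟨ S-*ˡ (allFin (length Δ)) (+ K) c ⟩
    + K * sumC c                                          ∎
    where open ≡-Reasoning

  odd⇔ : ∀ {α N} → Cone Δ α → ⟪ ht , α ⟫ ≡ + K * + N → HasOddHeight Δ α ⇔ N % 2 ≡ 1
  odd⇔ {α} {N} (c₀ , c₀↦α , _) ht[α] = mk⇔ to from
    where
    height : ∀ {c} → combo Δ c ≡ α → sumC c ≡ + N
    height {c} refl = ℤP.*-cancelˡ-≡ (+ K) (sumC c) (+ N) (trans (sym (ht-combo c)) ht[α])
    to : HasOddHeight Δ α → N % 2 ≡ 1
    to (c , c↦α , odd) = subst (λ h → ∣ h ∣ % 2 ≡ 1) (height c↦α) odd
    from : N % 2 ≡ 1 → HasOddHeight Δ α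
    from odd = c₀ , c₀↦α , subst (λ h → ∣ h ∣ % 2 ≡ 1) (sym (height c₀↦α)) odd

map⁺-on : {A B : Set} {f : A → B} {xs : List A} → Unique xs →
          (∀ {x y} → x ∈ xs → y ∈ xs → f x ≡ f y → x ≡ y) → Unique (List.map f xs)
map⁺-on AllPairs.[] inj = AllPairs.[]
map⁺-on (x∉xs AllPairs.∷ u) inj =
  AllP.map⁺ (All.tabulate (λ y∈xs fx≡fy → All.lookup x∉xs y∈xs (inj (here refl) (there y∈xs) fx≡fy)))
  AllPairs.∷ map⁺-on u (λ x∈ y∈ → inj (there x∈) (there y∈))

concatMap⁺ : {A B : Set} {f : A → List B} {xs : List A} → Unique xs → (∀ x → Unique (f x)) →
             (∀ {x y z} → z ∈ f x → z ∈ f y → x ≡ y) → Unique (concatMap f xs)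
concatMap⁺ {xs = xs} u uf disjoint =
  UniqueP.concat⁺ (AllP.map⁺ (All.universal uf xs))
                  (AllPairsP.map⁺ (AllPairs.map (λ x≢y {_} (z∈fx , z∈fy) → x≢y (disjoint z∈fx z∈fy)) u))

HasCard-⇔ : ∀ {n} {P Q : V n → Set} {k} → (∀ α → P α ⇔ Q α) → HasCard P k → HasCard Q k
HasCard-⇔ P⇔Q (l , u , mem , len) =
  l , u , (λ α → (Equivalence.to (P⇔Q α) ∘ proj₁ (mem α)) , (proj₂ (mem α) ∘ Equivalence.from (P⇔Q α))) , len

HasCard-⊎ : ∀ {n} {P Q : V n → Set} {a b} → HasCard P a → HasCard Q b → (∀ {α} → P α → Q α → ⊥) →
            HasCard (λ α → P α ⊎ Q α) (a ℕ.+ b)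
HasCard-⊎ {P = P} {Q} (l₁ , u₁ , mem₁ , refl) (l₂ , u₂ , mem₂ , refl) disjoint =
  l₁ ++ l₂ ,
  UniqueP.++⁺ u₁ u₂ (λ (α∈l₁ , α∈l₂) → disjoint (proj₁ (mem₁ _) α∈l₁) (proj₁ (mem₂ _) α∈l₂)) ,
  (λ α → [ inj₁ ∘ proj₁ (mem₁ α) , inj₂ ∘ proj₁ (mem₂ α) ] ∘ ∈P.∈-++⁻ l₁ ,
         [ ∈P.∈-++⁺ˡ ∘ proj₂ (mem₁ α) , ∈P.∈-++⁺ʳ l₁ ∘ proj₂ (mem₂ α) ]) ,
  ListP.length-++ l₁

record Selected {n} {L : Set} (X : List L) (s : L → V n) (P : L → Bool) (α : V n) : Set where
  constructor selected
  field
    label : L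
    label∈ : label ∈ X
    α≡ : α ≡ s label
    test : T (P label)

InjectiveOn : ∀ {n} {L : Set} → List L → (L → V n) → Set
InjectiveOn X s = ∀ {x y} → x ∈ X → y ∈ X → s x ≡ s y → x ≡ y

HasCard-selected : ∀ {n} {L : Set} {X : List L} {s : L → V n} → Unique X → InjectiveOn X s →
                   (P : L → Bool) → HasCard (Selected X s P) (count P X)
HasCard-selected {X = X} {s} u inj P =
  List.map s (filterᵇ P X) ,
  map⁺-on (UniqueP.filter⁺ P? u) (λ x∈ y∈ → inj (proj₁ (∈P.∈-filter⁻ P? x∈)) (proj₁ (∈P.∈-filter⁻ P? y∈))) ,
  (λ α → (λ α∈ → let x , x∈ , α≡ , Px = ∈P.∈-map∘filter⁻ s P? α∈ in selected x x∈ α≡ Px) ,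
         (λ (selected x x∈ α≡ Px) → ∈P.∈-map∘filter⁺ s P? (x , x∈ , α≡ , Px))) ,
  ListP.length-map s (filterᵇ P X)
  where P? : ∀ x → Dec (T (P x))
        P? x = T? (P x)

apart : ∀ {n} {L M : Set} {X : List L} {Y : List M} {s : L → V n} {t : M → V n} {P : L → Bool} {Q : M → Bool}
        (w : Fin n → ℤ) {a b : ℤ} → (∀ x → ⟪ w , s x ⟫ ≡ a) → (∀ y → ⟪ w , t y ⟫ ≡ b) → a ≢ b →
        ∀ {α} → Selected X s P α → Selected Y t Q α → ⊥
apart w ws wt a≢b (selected x _ refl _) (selected y _ α≡ _) = a≢b (trans (sym (ws x)) (trans (cong ⟪ w ,_⟫ α≡) (wt y)))

∈-concatMap⁺ : {A B : Set} (f : A → List B) {xs : List A} {x : A} {y : B} → x ∈ xs → y ∈ f x → y ∈ concatMap f xs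
∈-concatMap⁺ f x∈xs y∈fx = ∈P.∈-concatMap⁺ f (lose x∈xs y∈fx)

∈-concatMap⁻ : {A B : Set} (f : A → List B) (xs : List A) {y : B} → y ∈ concatMap f xs → ∃[ x ] x ∈ xs × y ∈ f x
∈-concatMap⁻ f xs y∈ = find (∈P.∈-concatMap⁻ f {xs = xs} y∈)

private
  pairsFrom : ∀ {n} → Fin n → List (Fin n × Fin n)
  pairsFrom {n} i = concatMap (λ j → if toℕ i <ᵇ toℕ j then (i , j) ∷ [] else []) (allFin n)

  ∈-if⁻ : {A : Set} (b : Bool) {x z : A} → z ∈ (if b then x ∷ [] else []) → T b × z ≡ x
  ∈-if⁻ true (here refl) = tt , refl

  ∈-pairsFrom⁻ : ∀ {n} {i : Fin n} {z} → z ∈ pairsFrom i → ∃[ j ] T (toℕ i <ᵇ toℕ j) × z ≡ (i , j)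
  ∈-pairsFrom⁻ {n} {i = i} z∈ with ∈-concatMap⁻ _ (allFin n) z∈
  ... | j , _ , z∈if = j , ∈-if⁻ (toℕ i <ᵇ toℕ j) z∈if

∈-pairs⁺ : ∀ {n} {i j : Fin n} → toℕ i ℕ.< toℕ j → (i , j) ∈ pairs n
∈-pairs⁺ {i = i} {j} i<j =
  ∈-concatMap⁺ pairsFrom (∈P.∈-allFin i) (∈-concatMap⁺ _ (∈P.∈-allFin j) (ifTrue (toℕ i <ᵇ toℕ j) (ℕP.<⇒<ᵇ i<j)))
  where ifTrue : (b : Bool) → T b → (i , j) ∈ (if b then (i , j) ∷ [] else [])
        ifTrue true _ = here refl

∈-pairs⁻ : ∀ {n} {i j : Fin n} → (i , j) ∈ pairs n → toℕ i ℕ.< toℕ j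
∈-pairs⁻ {n} z∈ with ∈-concatMap⁻ pairsFrom (allFin n) z∈
... | i′ , _ , z∈i′ with ∈-pairsFrom⁻ {i = i′} z∈i′
... | j′ , lt , refl = ℕP.<ᵇ⇒< _ _ lt

pairs-unique : ∀ n → Unique (pairs n)
pairs-unique n = concatMap⁺ (UniqueP.allFin⁺ n) inner-unique (λ z∈i z∈i′ → trans (sym (first z∈i)) (first z∈i′))
  where
  first : ∀ {i z} → z ∈ pairsFrom i → proj₁ z ≡ i
  first {i} z∈ with ∈-pairsFrom⁻ {i = i} z∈
  ... | _ , _ , refl = refl
  single : ∀ {A : Set} b (x : A) → Unique (if b then x ∷ [] else [])
  single true x = All.[] AllPairs.∷ AllPairs.[]
  single false x = AllPairs.[]
  inner-unique : ∀ i → Unique (pairsFrom i)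
  inner-unique i = concatMap⁺ (UniqueP.allFin⁺ n) (λ j → single _ _)
    (λ {j} {j′} z∈j z∈j′ →
       cong proj₂ (trans (sym (proj₂ (∈-if⁻ (toℕ i <ᵇ toℕ j) z∈j))) (proj₂ (∈-if⁻ (toℕ i <ᵇ toℕ j′) z∈j′))))

Signed : ∀ {n} {L : Set} → List L → (L → V n) → V n → Set
Signed X s γ = ∃[ x ] x ∈ X × (γ ≡ s x ⊎ γ ≡ negV (s x))

∈-±⁻ : ∀ {n} {L : Set} (f : L → V n) (X : List L) {γ} → γ ∈ concatMap (λ x → pm (f x)) X → Signed X f γ
∈-±⁻ f X γ∈ with ∈-concatMap⁻ (λ x → pm (f x)) X γ∈
... | x , x∈X , here refl = x , x∈X , inj₁ refl
... | x , x∈X , there (here refl) = x , x∈X , inj₂ refl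

∈-±⁺ : ∀ {n} {L : Set} (f : L → V n) {X : List L} {x} → x ∈ X → f x ∈ concatMap (λ x → pm (f x)) X
∈-±⁺ f x∈X = ∈-concatMap⁺ (λ x → pm (f x)) x∈X (here refl)

∈-∓⁺ : ∀ {n} {L : Set} (f : L → V n) {X : List L} {x} → x ∈ X → negV (f x) ∈ concatMap (λ x → pm (f x)) X
∈-∓⁺ f x∈X = ∈-concatMap⁺ (λ x → pm (f x)) x∈X (there (here refl))

NegClosed : ∀ {n} → List (V n) → Set
NegClosed Φ = ∀ {γ} → γ ∈ Φ → negV γ ∈ Φ

±-negClosed : ∀ {n} {L : Set} (f : L → V n) (X : List L) → NegClosed (concatMap (λ x → pm (f x)) X)
±-negClosed f X γ∈ with ∈-±⁻ f X γ∈
... | x , x∈X , inj₁ refl = ∈-∓⁺ f x∈X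
... | x , x∈X , inj₂ refl = subst (_∈ concatMap (λ x → pm (f x)) X) (sym (negV-involutive (f x))) (∈-±⁺ f x∈X)

++-negClosed : ∀ {n} {Φ₁ Φ₂ : List (V n)} → NegClosed Φ₁ → NegClosed Φ₂ → NegClosed (Φ₁ ++ Φ₂)
++-negClosed {Φ₁ = Φ₁} c₁ c₂ γ∈ with ∈P.∈-++⁻ Φ₁ γ∈
... | inj₁ γ∈₁ = ∈P.∈-++⁺ˡ (c₁ γ∈₁)
... | inj₂ γ∈₂ = ∈P.∈-++⁺ʳ Φ₁ (c₂ γ∈₂)

∈-++₃⁻ : ∀ {n} (A P : List (V n)) {Ψ : List (V n)} {γ} → γ ∈ A ++ P ++ Ψ → γ ∈ A ⊎ γ ∈ P ⊎ γ ∈ Ψ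
∈-++₃⁻ A P γ∈ with ∈P.∈-++⁻ A γ∈
... | inj₁ γ∈A = inj₁ γ∈A
... | inj₂ γ∈PΨ = inj₂ (∈P.∈-++⁻ P γ∈PΨ)

∈-++₃⁺ʳ : ∀ {n} (A P : List (V n)) {Ψ : List (V n)} {γ} → γ ∈ Ψ → γ ∈ A ++ P ++ Ψ
∈-++₃⁺ʳ A P γ∈ = ∈P.∈-++⁺ʳ A (∈P.∈-++⁺ʳ P γ∈)

-- The shapes of positive roots: e_j − e_i and e_i + e_j for pairs i < j, and 2e_i.
-- (The fourth shape, e_i, is the basis vector itself.)
diff : ∀ {n} → Fin n × Fin n → V n
diff (i , j) = e j ⊖ e i

plus : ∀ {n} → Fin n × Fin n → V n
plus (i , j) = e i ⊕ e j

double : ∀ {n} → Fin n → V n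
double i = scale (+ 2) (e i)

pair≢ : ∀ {n} {i j : Fin n} → (i , j) ∈ pairs n → i ≢ j
pair≢ ij∈ refl = ℕP.<-irrefl refl (∈-pairs⁻ ij∈)

δ-cases : ∀ {n} (a m : Fin n) → (a ≡ m × δ a m ≡ + 1) ⊎ (a ≢ m × δ a m ≡ + 0)
δ-cases a m with a FinP.≟ m
... | yes a≡m = inj₁ (a≡m , refl)
... | no a≢m = inj₂ (a≢m , refl)

lookup-diff : ∀ {n} (i j m : Fin n) → lookup (e j ⊖ e i) m ≡ δ j m - δ i m
lookup-diff i j m = trans (VecP.lookup-zipWith _-_ m (e j) (e i)) (cong₂ _-_ (lookup-e j m) (lookup-e i m))

lookup-plus : ∀ {n} (i j m : Fin n) → lookup (e i ⊕ e j) m ≡ δ i m + δ j m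
lookup-plus i j m = trans (VecP.lookup-zipWith _+_ m (e i) (e j)) (cong₂ _+_ (lookup-e i m) (lookup-e j m))

lookup-double : ∀ {n} (i m : Fin n) → lookup (double i) m ≡ + 2 * δ i m
lookup-double i m = trans (VecP.lookup-map m (+ 2 *_) (e i)) (cong (+ 2 *_) (lookup-e i m))

-- The labels of a shape are recovered from its coordinates: a coordinate 1 of
-- e_j − e_i sits at j, a coordinate −1 at i, and a coordinate 1 of e_i + e_j at
-- i or j.  Hence the shapes are injective on their labels.
diff-top : ∀ {n} (i j m : Fin n) → lookup (e j ⊖ e i) m ≡ + 1 → j ≡ m
diff-top i j m eq with δ-cases j m | δ-cases i m | trans (sym eq) (lookup-diff i j m)
... | inj₁ (j≡m , _) | _ | _ = j≡m
... | inj₂ (_ , δj≡0) | inj₁ (_ , δi≡1) | 1≡ = contradiction (trans 1≡ (cong₂ _-_ δj≡0 δi≡1)) λ ()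
... | inj₂ (_ , δj≡0) | inj₂ (_ , δi≡0) | 1≡ = contradiction (trans 1≡ (cong₂ _-_ δj≡0 δi≡0)) λ ()

diff-bottom : ∀ {n} (i j m : Fin n) → lookup (e j ⊖ e i) m ≡ -[1+ 0 ] → i ≡ m
diff-bottom i j m eq with δ-cases i m | δ-cases j m | trans (sym eq) (lookup-diff i j m)
... | inj₁ (i≡m , _) | _ | _ = i≡m
... | inj₂ (_ , δi≡0) | inj₁ (_ , δj≡1) | -1≡ = contradiction (trans -1≡ (cong₂ _-_ δj≡1 δi≡0)) λ ()
... | inj₂ (_ , δi≡0) | inj₂ (_ , δj≡0) | -1≡ = contradiction (trans -1≡ (cong₂ _-_ δj≡0 δi≡0)) λ ()

plus-support : ∀ {n} (i j m : Fin n) → lookup (e i ⊕ e j) m ≡ + 1 → i ≡ m ⊎ j ≡ m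
plus-support i j m eq with δ-cases i m | δ-cases j m
... | inj₁ (i≡m , _) | _ = inj₁ i≡m
... | inj₂ _ | inj₁ (j≡m , _) = inj₂ j≡m
... | inj₂ (_ , δi≡0) | inj₂ (_ , δj≡0) =
  contradiction (trans (sym eq) (trans (lookup-plus i j m) (cong₂ _+_ δi≡0 δj≡0))) λ ()

δ-one : ∀ {n} {a m : Fin n} → δ a m ≡ + 1 → a ≡ m
δ-one {a = a} {m} eq with δ-cases a m
... | inj₁ (a≡m , _) = a≡m
... | inj₂ (_ , δ≡0) = contradiction (trans (sym eq) δ≡0) λ ()

diff-injective : ∀ {n} → InjectiveOn (pairs n) diff
diff-injective {x = i , j} {i′ , j′} ij∈ ij′∈ eq = cong₂ _,_ (sym i′≡i) (sym j′≡j)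
  where
  at : ∀ m → lookup (e j′ ⊖ e i′) m ≡ δ j m - δ i m
  at m = trans (cong (λ v → lookup v m) (sym eq)) (lookup-diff i j m)
  j′≡j = diff-top i′ j′ j (trans (at j) (cong₂ _-_ (δ-diag j) (δ-off (pair≢ ij∈ ∘ sym))))
  i′≡i = diff-bottom i′ j′ i (trans (at i) (cong₂ _-_ (δ-off (pair≢ ij∈)) (δ-diag i)))

plus-injective : ∀ {n} → InjectiveOn (pairs n) plus
plus-injective {x = i , j} {i′ , j′} ij∈ ij′∈ eq =
  match (hit i (cong₂ _+_ (δ-diag i) (δ-off i≢j))) (hit j (cong₂ _+_ (δ-off (i≢j ∘ sym)) (δ-diag j)))
  where
  i≢j = pair≢ ij∈
  hit : ∀ m → δ i m + δ j m ≡ + 1 → i′ ≡ m ⊎ j′ ≡ m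
  hit m h = plus-support i′ j′ m (trans (cong (λ v → lookup v m) (sym eq)) (trans (lookup-plus i j m) h))
  match : i′ ≡ i ⊎ j′ ≡ i → i′ ≡ j ⊎ j′ ≡ j → (i , j) ≡ (i′ , j′)
  match (inj₁ refl) (inj₂ refl) = refl
  match (inj₁ refl) (inj₁ i≡j) = contradiction i≡j i≢j
  match (inj₂ refl) (inj₂ i≡j) = contradiction i≡j i≢j
  match (inj₂ refl) (inj₁ refl) = contradiction (∈-pairs⁻ ij∈) (ℕP.<-asym (∈-pairs⁻ ij′∈))

e-injective : ∀ {n} {i j : Fin n} → e i ≡ e j → i ≡ j
e-injective {i = i} {j} eq =
  sym (δ-one (trans (sym (lookup-e j i)) (trans (cong (λ v → lookup v i) (sym eq)) (trans (lookup-e i i) (δ-diag i)))))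

double-injective : ∀ {n} {i j : Fin n} → double i ≡ double j → i ≡ j
double-injective {i = i} {j} eq = sym (δ-one (ℤP.*-cancelˡ-≡ (+ 2) (δ j i) (+ 1) twice))
  where twice : + 2 * δ j i ≡ + 2 * + 1
        twice = trans (sym (lookup-double j i)) (trans (cong (λ v → lookup v i) (sym eq)) (trans (lookup-double i i) (cong (+ 2 *_) (δ-diag i))))

-- A coordinate of 2e_m is even, while e_i + e_j has a coordinate 1: these two
-- shapes never coincide.
twice-δ≢1 : ∀ {n} (a m : Fin n) → + 2 * δ a m ≢ + 1
twice-δ≢1 a m with δ-cases a m
... | inj₁ (_ , δ≡1) rewrite δ≡1 = λ ()
... | inj₂ (_ , δ≡0) rewrite δ≡0 = λ ()

plus≢double : ∀ {n} {i j m : Fin n} → (i , j) ∈ pairs n → plus (i , j) ≢ double m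
plus≢double {i = i} {j} {m} ij∈ eq = twice-δ≢1 m i
  (trans (sym (lookup-double m i)) (trans (cong (λ v → lookup v i) (sym eq))
         (trans (lookup-plus i j i) (cong₂ _+_ (δ-diag i) (δ-off (pair≢ ij∈))))))

-- The coordinate sum is 0 on e_j − e_i, 1 on e_i and 2 on e_i + e_j and 2e_i,
-- which separates the families of shapes.
𝟙 : ∀ {n} → Fin n → ℤ
𝟙 _ = + 1

𝟙-diff : ∀ {n} (x : Fin n × Fin n) → ⟪ 𝟙 , diff x ⟫ ≡ + 0
𝟙-diff (i , j) = trans (⟪⟫-⊖ 𝟙 (e j) (e i)) (cong₂ _-_ (⟪⟫-e 𝟙 j) (⟪⟫-e 𝟙 i))

𝟙-plus : ∀ {n} (x : Fin n × Fin n) → ⟪ 𝟙 , plus x ⟫ ≡ + 2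
𝟙-plus (i , j) = trans (⟪⟫-⊕ 𝟙 (e i) (e j)) (cong₂ _+_ (⟪⟫-e 𝟙 i) (⟪⟫-e 𝟙 j))

𝟙-double : ∀ {n} (i : Fin n) → ⟪ 𝟙 , double i ⟫ ≡ + 2
𝟙-double i = trans (⟪⟫-scale 𝟙 (+ 2) (e i)) (cong (+ 2 *_) (⟪⟫-e 𝟙 i))

ρ-diff : ∀ {n} {x : Fin n × Fin n} → x ∈ pairs n → + 0 ℤ.< ⟪ ρ , diff x ⟫
ρ-diff {x = i , j} ij∈ = subst (+ 0 ℤ.<_) (sym (trans (⟪⟫-⊖ ρ (e j) (e i)) (cong₂ _-_ (⟪⟫-e ρ j) (⟪⟫-e ρ i))))
  (subst (ℤ._< ρ j - ρ i) (ℤP.+-inverseʳ (ρ i)) (ℤP.+-monoˡ-< (- ρ i) (+<+ (s≤s (∈-pairs⁻ ij∈)))))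

ρ-plus : ∀ {n} (x : Fin n × Fin n) → + 0 ℤ.< ⟪ ρ , plus x ⟫
ρ-plus (i , j) = subst (+ 0 ℤ.<_) (sym (trans (⟪⟫-⊕ ρ (e i) (e j)) (cong₂ _+_ (⟪⟫-e ρ i) (⟪⟫-e ρ j)))) (+<+ (s≤s z≤n))

ρ-e : ∀ {n} (i : Fin n) → + 0 ℤ.< ⟪ ρ , e i ⟫
ρ-e i = subst (+ 0 ℤ.<_) (sym (⟪⟫-e ρ i)) (+<+ (s≤s z≤n))

ρ-double : ∀ {n} (i : Fin n) → + 0 ℤ.< ⟪ ρ , double i ⟫
ρ-double i = subst (+ 0 ℤ.<_) (sym (trans (⟪⟫-scale ρ (+ 2) (e i)) (cong (+ 2 *_) (⟪⟫-e ρ i))))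
  (ℤP.*-monoˡ-<-pos (+ 2) (+<+ (s≤s z≤n)))

rootsA-signed : ∀ {n} {γ : V n} → γ ∈ rootsA n → Signed (pairs n) diff γ
rootsA-signed {n} γ∈ with ∈-±⁻ (λ x → e (proj₁ x) ⊖ e (proj₂ x)) (pairs n) γ∈
... | (i , j) , ij∈ , inj₁ refl = (i , j) , ij∈ , inj₂ (sym (negV-⊖ (e j) (e i)))
... | (i , j) , ij∈ , inj₂ refl = (i , j) , ij∈ , inj₁ (negV-⊖ (e i) (e j))

diff∈rootsA : ∀ {n} {x : Fin n × Fin n} → x ∈ pairs n → diff x ∈ rootsA n
diff∈rootsA {n} {i , j} ij∈ = subst (_∈ rootsA n) (negV-⊖ (e i) (e j)) (∈-∓⁺ (λ x → e (proj₁ x) ⊖ e (proj₂ x)) ij∈)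

rootsPlus-signed : ∀ {n} {γ : V n} → γ ∈ rootsPlus n → Signed (pairs n) plus γ
rootsPlus-signed {n} = ∈-±⁻ plus (pairs n)

fin-cmp : ∀ {n} {p q : Fin n} → p ≢ q → toℕ p ℕ.< toℕ q ⊎ toℕ q ℕ.< toℕ p
fin-cmp {p = p} {q} p≢q with ℕP.<-cmp (toℕ p) (toℕ q)
... | tri< p<q _ _ = inj₁ p<q
... | tri≈ _ p≡q _ = contradiction (FinP.toℕ-injective p≡q) p≢q
... | tri> _ _ q<p = inj₂ q<p

e-diff∈rootsA : ∀ {n} {p q : Fin n} → p ≢ q → e q ⊖ e p ∈ rootsA n
e-diff∈rootsA {n} {p} {q} p≢q with fin-cmp p≢q
... | inj₁ p<q = diff∈rootsA (∈-pairs⁺ p<q)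
... | inj₂ q<p = ∈-±⁺ (λ x → e (proj₁ x) ⊖ e (proj₂ x)) (∈-pairs⁺ q<p)

e-plus∈rootsPlus : ∀ {n} {p q : Fin n} → p ≢ q → e p ⊕ e q ∈ rootsPlus n
e-plus∈rootsPlus {n} {p} {q} p≢q with fin-cmp p≢q
... | inj₁ p<q = ∈-±⁺ plus (∈-pairs⁺ p<q)
... | inj₂ q<p = subst (_∈ rootsPlus n) (⊕-comm (e q) (e p)) (∈-±⁺ plus (∈-pairs⁺ q<p))

E-sum∈ΦD : ∀ {n} (a b : Bool) {p q : Fin n} → p ≢ q → E a p ⊕ E b q ∈ ΦD n
E-sum∈ΦD false false p≢q = ∈P.∈-++⁺ʳ (rootsA _) (e-plus∈rootsPlus p≢q)
E-sum∈ΦD true true {p} {q} p≢q =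
  ∈P.∈-++⁺ʳ (rootsA _) (subst (_∈ rootsPlus _) (sym (negV-⊕ (e p) (e q))) (±-negClosed plus (pairs _) (e-plus∈rootsPlus p≢q)))
E-sum∈ΦD false true {p} {q} p≢q =
  ∈P.∈-++⁺ˡ (subst (_∈ rootsA _) (⊖-as-⊕ (e p) (e q)) (e-diff∈rootsA (p≢q ∘ sym)))
E-sum∈ΦD true false {p} {q} p≢q =
  ∈P.∈-++⁺ˡ (subst (_∈ rootsA _) (trans (⊖-as-⊕ (e q) (e p)) (⊕-comm (e q) (negV (e p)))) (e-diff∈rootsA p≢q))

ΦD⊆ : ∀ {n} (Ψ : List (V n)) {γ} → γ ∈ ΦD n → γ ∈ rootsA n ++ rootsPlus n ++ Ψ
ΦD⊆ {n} Ψ γ∈ with ∈P.∈-++⁻ (rootsA n) γ∈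
... | inj₁ γ∈A = ∈P.∈-++⁺ˡ γ∈A
... | inj₂ γ∈P = ∈P.∈-++⁺ʳ (rootsA n) (∈P.∈-++⁺ˡ γ∈P)

⊖-E : ∀ {n} (u : V n) (b : Bool) (p : Fin n) → u ⊖ E b p ≡ u ⊕ E (not b) p
⊖-E u true p = trans (⊖-as-⊕ u (negV (e p))) (cong (u ⊕_) (negV-involutive (e p)))
⊖-E u false p = ⊖-as-⊕ u (e p)

perm≢ : ∀ {n} (σ : SignedPerm n) {i j : Fin n} → i ≢ j → perm σ i ≢ perm σ j
perm≢ σ i≢j = i≢j ∘ perm-inj σ

act-diff : ∀ {n} (σ : SignedPerm n) (i j : Fin n) → act σ (diff (i , j)) ≡ E (neg σ j) (perm σ j) ⊖ E (neg σ i) (perm σ i)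
act-diff σ i j = trans (act-⊖ σ (e j) (e i)) (cong₂ _⊖_ (act-e σ j) (act-e σ i))

act-plus : ∀ {n} (σ : SignedPerm n) (i j : Fin n) → act σ (plus (i , j)) ≡ E (neg σ i) (perm σ i) ⊕ E (neg σ j) (perm σ j)
act-plus σ i j = trans (act-⊕ σ (e i) (e j)) (cong₂ _⊕_ (act-e σ i) (act-e σ j))

act-diff∈ΦD : ∀ {n} (σ : SignedPerm n) {i j : Fin n} → i ≢ j → act σ (diff (i , j)) ∈ ΦD n
act-diff∈ΦD σ {i} {j} i≢j =
  subst (_∈ ΦD _) (sym (trans (act-diff σ i j) (⊖-E _ (neg σ i) (perm σ i))))
    (E-sum∈ΦD (neg σ j) (not (neg σ i)) (perm≢ σ (i≢j ∘ sym)))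

act-plus∈ΦD : ∀ {n} (σ : SignedPerm n) {i j : Fin n} → i ≢ j → act σ (plus (i , j)) ∈ ΦD n
act-plus∈ΦD σ {i} {j} i≢j = subst (_∈ ΦD _) (sym (act-plus σ i j)) (E-sum∈ΦD (neg σ i) (neg σ j) (perm≢ σ i≢j))

act-diff∈rootsA : ∀ {n} (σ : SignedPerm n) → InS σ → {i j : Fin n} → i ≢ j → act σ (diff (i , j)) ∈ rootsA n
act-diff∈rootsA σ unsigned {i} {j} i≢j rewrite act-diff σ i j | unsigned i | unsigned j = e-diff∈rootsA (perm≢ σ i≢j)

ρ-act-diff : ∀ {n} (σ : SignedPerm n) (i j : Fin n) → ⟪ ρ , act σ (diff (i , j)) ⟫ ≡ window σ j - window σ i
ρ-act-diff σ i j = trans (cong ⟪ ρ ,_⟫ (act-⊖ σ (e j) (e i)))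
  (trans (⟪⟫-⊖ ρ (act σ (e j)) (act σ (e i))) (cong₂ _-_ (ρ-act-e σ j) (ρ-act-e σ i)))

ρ-act-plus : ∀ {n} (σ : SignedPerm n) (i j : Fin n) → ⟪ ρ , act σ (plus (i , j)) ⟫ ≡ window σ i + window σ j
ρ-act-plus σ i j = trans (cong ⟪ ρ ,_⟫ (act-⊕ σ (e i) (e j)))
  (trans (⟪⟫-⊕ ρ (act σ (e i)) (act σ (e j))) (cong₂ _+_ (ρ-act-e σ i) (ρ-act-e σ j)))

ρ-act-double : ∀ {n} (σ : SignedPerm n) (i : Fin n) → ⟪ ρ , act σ (double i) ⟫ ≡ + 2 * window σ i
ρ-act-double σ i = trans (cong ⟪ ρ ,_⟫ (act-scale σ (+ 2) (e i)))
  (trans (⟪⟫-scale ρ (+ 2) (act σ (e i))) (cong (+ 2 *_) (ρ-act-e σ i)))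

T-does : {P : Set} (d : Dec P) → T (does d) ⇔ P
T-does (yes p) = mk⇔ (λ _ → p) (λ _ → _)
T-does (no ¬p) = mk⇔ (λ ()) ¬p

T-odd : ∀ k → T (oddℕ k) ⇔ (k % 2 ≡ 1)
T-odd k = mk⇔ (ℕP.≡ᵇ⇒≡ (k % 2) 1) (ℕP.≡⇒≡ᵇ (k % 2) 1)

T-even : ∀ k → T (evenℕ k) ⇔ (k % 2 ≡ 0)
T-even k = mk⇔ (ℕP.≡ᵇ⇒≡ (k % 2) 0) (ℕP.≡⇒≡ᵇ (k % 2) 0)

≡-⇔ : ∀ {x y c : ℕ} → x ≡ y → (x ≡ c) ⇔ (y ≡ c)
≡-⇔ refl = ⇔.refl

parity-+ : ∀ {i j} → i ℕ.≤ j → (i ℕ.+ j) % 2 ≡ (j ∸ i) % 2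
parity-+ {i} {j} i≤j = begin
  (i ℕ.+ j) % 2                   ≡⟨ cong (λ k → (i ℕ.+ k) % 2) (sym (ℕP.m∸n+n≡m i≤j)) ⟩
  (i ℕ.+ ((j ∸ i) ℕ.+ i)) % 2     ≡⟨ cong (_% 2) (ring i (j ∸ i)) ⟩
  ((j ∸ i) ℕ.+ i ℕ.* 2) % 2       ≡⟨ [m+kn]%n≡m%n (j ∸ i) i 2 ⟩
  (j ∸ i) % 2                     ∎
  where open ≡-Reasoning
        ring : ∀ i d → i ℕ.+ (d ℕ.+ i) ≡ d ℕ.+ i ℕ.* 2
        ring = ℕ-Solver.solve-∀

suc-odd⇔even : ∀ k → (suc k % 2 ≡ 1) ⇔ (k % 2 ≡ 0)
suc-odd⇔even zero = mk⇔ (λ _ → refl) (λ _ → refl)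
suc-odd⇔even (suc zero) = mk⇔ (λ ()) (λ ())
suc-odd⇔even (suc (suc k)) = suc-odd⇔even k

-<0⇔< : ∀ a b → (a - b ℤ.< + 0) ⇔ (a ℤ.< b)
-<0⇔< a b = mk⇔ to from
  where
  to : a - b ℤ.< + 0 → a ℤ.< b
  to a-b<0 = subst₂ ℤ._<_ (ring a b) (ℤP.+-identityˡ b) (ℤP.+-monoˡ-< b a-b<0)
    where ring : ∀ a b → (a - b) + b ≡ a
          ring = solve-∀
  from : a ℤ.< b → a - b ℤ.< + 0
  from a<b = subst (a - b ℤ.<_) (ℤP.+-inverseʳ b) (ℤP.+-monoˡ-< (- b) a<b)

2*<0⇔<0 : ∀ a → (+ 2 * a ℤ.< + 0) ⇔ (a ℤ.< + 0)
2*<0⇔<0 a = mk⇔ (ℤP.*-cancelˡ-<-nonNeg (+ 2)) (ℤP.*-monoˡ-<-pos (+ 2))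

negative-via : ∀ {x t : ℤ} {Q : Set} → x ≡ t → (t ℤ.< + 0) ⇔ Q → (x ℤ.< + 0) ⇔ Q
negative-via refl t<0⇔Q = t<0⇔Q

aff : ∀ {n} → ℕ → ℕ → Fin n → ℤ
aff K B m = + (K ℕ.* toℕ m ℕ.+ B)

aff-diff : ∀ {n} (K B : ℕ) {i j : Fin n} → toℕ i ℕ.≤ toℕ j → ⟪ aff K B , diff (i , j) ⟫ ≡ + K * + (toℕ j ∸ toℕ i)
aff-diff K B {i} {j} i≤j = begin
  ⟪ aff K B , e j ⊖ e i ⟫                  ≡⟨ ⟪⟫-⊖ (aff K B) (e j) (e i) ⟩
  ⟪ aff K B , e j ⟫ - ⟪ aff K B , e i ⟫    ≡⟨ cong₂ _-_ (⟪⟫-e (aff K B) j) (⟪⟫-e (aff K B) i) ⟩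
  + (K ℕ.* toℕ j ℕ.+ B) - + b              ≡⟨ cong (λ t → + (K ℕ.* t ℕ.+ B) - + b) (sym (ℕP.m∸n+n≡m i≤j)) ⟩
  + (K ℕ.* (d ℕ.+ toℕ i) ℕ.+ B) - + b      ≡⟨ cong (λ t → + t - + b) (ring K d (toℕ i) B) ⟩
  (+ (K ℕ.* d) + + b) - + b                ≡⟨ cancel (+ (K ℕ.* d)) (+ b) ⟩
  + (K ℕ.* d)                              ≡⟨ ℤP.pos-* K d ⟩
  + K * + d                                ∎
  where open ≡-Reasoning
        d = toℕ j ∸ toℕ i
        b = K ℕ.* toℕ i ℕ.+ B
        ring : ∀ K d i B → K ℕ.* (d ℕ.+ i) ℕ.+ B ≡ K ℕ.* d ℕ.+ (K ℕ.* i ℕ.+ B)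
        ring = ℕ-Solver.solve-∀
        cancel : ∀ x y → (x + y) - y ≡ x
        cancel = solve-∀

aff-step : ∀ {n} (K B : ℕ) {i j : Fin n} → toℕ j ≡ suc (toℕ i) → ⟪ aff K B , e j ⊖ e i ⟫ ≡ + K
aff-step K B {i} {j} j≡1+i =
  trans (aff-diff K B (subst (toℕ i ℕ.≤_) (sym j≡1+i) (ℕP.n≤1+n (toℕ i))))
        (trans (cong (λ t → + K * + (t ∸ toℕ i)) j≡1+i)
               (trans (cong (λ t → + K * + t) (ℕP.m+n∸n≡m 1 (toℕ i))) (ℤP.*-identityʳ (+ K))))

-- The statistics of Defs as tests on positions and pairs of positions; by
-- definition count (oddInversion σ) (pairs n) is oinv σ, and so on.
oddNegative : ∀ {n} → SignedPerm n → Fin n → Bool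
oddNegative σ i = isNeg (window σ i) ∧ evenℕ (toℕ i)

negative : ∀ {n} → SignedPerm n → Fin n → Bool
negative σ i = isNeg (window σ i)

oddInversion : ∀ {n} → SignedPerm n → Fin n × Fin n → Bool
oddInversion σ (i , j) = does (window σ j <? window σ i) ∧ oddℕ (toℕ j ∸ toℕ i)

oddNegativeSum : ∀ {n} → SignedPerm n → Fin n × Fin n → Bool
oddNegativeSum σ (i , j) = isNeg (window σ i + window σ j) ∧ oddℕ (toℕ j ∸ toℕ i)

evenNegativeSum : ∀ {n} → SignedPerm n → Fin n × Fin n → Bool
evenNegativeSum σ (i , j) = isNeg (window σ i + window σ j) ∧ evenℕ (toℕ j ∸ toℕ i)

signed-split : ∀ {n} (Δ : List (V n)) {L : Set} {X : List L} {s : L → V n} →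
               (∀ {x} → x ∈ X → Cone Δ (s x) × + 0 ℤ.< ⟪ ρ , s x ⟫) →
               ∀ {γ} → Signed X s γ → (Cone Δ γ × + 0 ℤ.< ⟪ ρ , γ ⟫) ⊎ ⟪ ρ , γ ⟫ ℤ.< + 0
signed-split Δ positive (x , x∈ , inj₁ refl) = inj₁ (positive x∈)
signed-split Δ {s = s} positive (x , x∈ , inj₂ refl) = inj₂ (⟪⟫-negV-< ρ (s x) (proj₂ (positive x∈)))

module RootData {n} (Φ Δ : List (V n))
  (ρ-Δ : ∀ {β} → β ∈ Δ → + 0 ℤ.≤ ⟪ ρ , β ⟫)
  (split : ∀ {γ} → γ ∈ Φ → (Cone Δ γ × + 0 ℤ.< ⟪ ρ , γ ⟫) ⊎ ⟪ ρ , γ ⟫ ℤ.< + 0)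
  (negV-closed : NegClosed Φ)
  (K′ B : ℕ) (ht-Δ : ∀ {β} → β ∈ Δ → ⟪ aff (suc K′) B , β ⟫ ≡ + suc K′) where

  open Positivity Φ Δ ρ-Δ split negV-closed public
  open Height Δ (aff (suc K′) B) (suc K′) ht-Δ public

  K : ℕ
  K = suc K′

  counted⇔ : (σ : SignedPerm n) {α : V n} {N : ℕ} → IsPositiveRoot Φ Δ α → ⟪ aff K B , α ⟫ ≡ + K * + N →
             act σ α ∈ Φ → LPred Φ Δ σ α ⇔ (⟪ ρ , act σ α ⟫ ℤ.< + 0 × N % 2 ≡ 1)
  counted⇔ σ α⁺@(_ , cone) ht[α] σα∈Φ =
    mk⇔ (λ (_ , odd , neg) → Equivalence.to (negative⇔ σα∈Φ) neg , Equivalence.to (odd⇔ cone ht[α]) odd)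
        (λ (ρ<0 , odd) → α⁺ , Equivalence.from (odd⇔ cone ht[α]) odd , Equivalence.from (negative⇔ σα∈Φ) ρ<0)

  counted⇔T : (σ : SignedPerm n) {α : V n} {N : ℕ} {sign parity : Bool} → IsPositiveRoot Φ Δ α →
              ⟪ aff K B , α ⟫ ≡ + K * + N → act σ α ∈ Φ →
              (⟪ ρ , act σ α ⟫ ℤ.< + 0) ⇔ T sign → (N % 2 ≡ 1) ⇔ T parity → LPred Φ Δ σ α ⇔ T (sign ∧ parity)
  counted⇔T σ α⁺ ht[α] σα∈Φ sign⇔ parity⇔ =
    ⇔.trans (counted⇔ σ α⁺ ht[α] σα∈Φ) (⇔.trans (sign⇔ ×-⇔ parity⇔) (⇔.sym T-∧))

  diff-criterion : (σ : SignedPerm n) {i j : Fin n} → (i , j) ∈ pairs n → IsPositiveRoot Φ Δ (diff (i , j)) →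
                   act σ (diff (i , j)) ∈ Φ →
                   LPred Φ Δ σ (diff (i , j)) ⇔ T (oddInversion σ (i , j))
  diff-criterion σ {i} {j} ij∈ α⁺ σα∈Φ =
    counted⇔T σ α⁺ (aff-diff K B (ℕP.<⇒≤ (∈-pairs⁻ ij∈))) σα∈Φ
      (negative-via (ρ-act-diff σ i j) (⇔.trans (-<0⇔< (window σ j) (window σ i)) (⇔.sym (T-does (window σ j <? window σ i)))))
      (⇔.sym (T-odd (toℕ j ∸ toℕ i)))

  plus-criterion : (σ : SignedPerm n) {i j : Fin n} {N : ℕ} {parity : Bool} → IsPositiveRoot Φ Δ (plus (i , j)) →
                   act σ (plus (i , j)) ∈ Φ → ⟪ aff K B , plus (i , j) ⟫ ≡ + K * + N → (N % 2 ≡ 1) ⇔ T parity →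
                   LPred Φ Δ σ (plus (i , j)) ⇔ T (isNeg (window σ i + window σ j) ∧ parity)
  plus-criterion σ {i} {j} α⁺ σα∈Φ ht[α] parity⇔ =
    counted⇔T σ α⁺ ht[α] σα∈Φ (negative-via (ρ-act-plus σ i j) (⇔.sym (T-does (window σ i + window σ j <? + 0)))) parity⇔

  module Family (σ : SignedPerm n) {L : Set} (X : List L) (s : L → V n) (P : L → Bool)
    (ρ-positive : ∀ {x} → x ∈ X → + 0 ℤ.< ⟪ ρ , s x ⟫)
    (criterion : ∀ {x} → x ∈ X → LPred Φ Δ σ (s x) ⇔ T (P x)) where

    selected⇒counted : ∀ {α} → Selected X s P α → LPred Φ Δ σ α
    selected⇒counted (selected x x∈ refl Px) = Equivalence.from (criterion x∈) Px

    counted⇒selected : ∀ {α} → Signed X s α → LPred Φ Δ σ α → Selected X s P α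
    counted⇒selected (x , x∈ , inj₁ refl) counted = selected x x∈ refl (Equivalence.to (criterion x∈) counted)
    counted⇒selected (x , x∈ , inj₂ refl) (α⁺ , _) =
      contradiction (proj₂ (Equivalence.to positive⇔ α⁺)) (ℤP.<-asym (⟪⟫-negV-< ρ (s x) (ρ-positive x∈)))

ΔA-steps : ∀ {n} → HasSteps (ΔA n)
ΔA-steps {suc k} i (Fin.suc t) j≡1+i
  rewrite FinP.toℕ-injective {i = i} {j = inject₁ t} (trans (sym (ℕP.suc-injective j≡1+i)) (sym (FinP.toℕ-inject₁ t))) =
  ∈P.∈-map⁺ (λ t → e (Fin.suc t) ⊖ e (inject₁ t)) (∈P.∈-allFin t)

ΔA-step : ∀ {n} {β : V n} → β ∈ ΔA n → ∃[ i ] ∃[ j ] toℕ j ≡ suc (toℕ i) × β ≡ e j ⊖ e i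
ΔA-step {suc k} β∈ with ∈P.∈-map⁻ (λ t → e (Fin.suc t) ⊖ e (inject₁ t)) β∈
... | t , _ , refl = inject₁ t , Fin.suc t , cong suc (sym (FinP.toℕ-inject₁ t)) , refl

ρ-ΔA : ∀ {n} {β : V n} → β ∈ ΔA n → + 0 ℤ.≤ ⟪ ρ , β ⟫
ρ-ΔA β∈ with ΔA-step β∈
... | i , j , j≡1+i , refl = ℤP.<⇒≤ (ρ-diff (∈-pairs⁺ (subst (toℕ i ℕ.<_) (sym j≡1+i) (ℕP.n<1+n (toℕ i)))))

aff-ΔA : ∀ {n} (K B : ℕ) {β : V n} → β ∈ ΔA n → ⟪ aff K B , β ⟫ ≡ + K
aff-ΔA K B β∈ with ΔA-step β∈
... | i , j , j≡1+i , refl = aff-step K B j≡1+i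

diff-positive : ∀ {n} {Δ : List (V n)} → HasSteps Δ → ∀ {x} → x ∈ pairs n → Cone Δ (diff x) × + 0 ℤ.< ⟪ ρ , diff x ⟫
diff-positive steps {i , j} ij∈ = cone-diff _ steps i j (ℕP.<⇒≤ (∈-pairs⁻ ij∈)) , ρ-diff ij∈

-- Type A: Φ = {±(e_i − e_j)}, Δ = steps, height form e_m ↦ m, σ unsigned.
-- L(σ) counts the roots e_j − e_i of odd height j − i with σ(j) < σ(i): the
-- odd inversions.
module TypeA (n : ℕ) where

  split : ∀ {γ} → γ ∈ ΦA n → (Cone (ΔA n) γ × + 0 ℤ.< ⟪ ρ , γ ⟫) ⊎ ⟪ ρ , γ ⟫ ℤ.< + 0
  split γ∈ = signed-split (ΔA n) (diff-positive ΔA-steps) (rootsA-signed γ∈)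

  open RootData (ΦA n) (ΔA n) ρ-ΔA split (±-negClosed _ (pairs n)) 0 1 (aff-ΔA 1 1)

  module Count (σ : SignedPerm n) (unsigned : InS σ) where

    diff-counted : ∀ {x} → x ∈ pairs n → LPred (ΦA n) (ΔA n) σ (diff x) ⇔ T (oddInversion σ x)
    diff-counted {i , j} ij∈ =
      diff-criterion σ ij∈ (diff∈rootsA ij∈ , proj₁ (diff-positive ΔA-steps ij∈)) (act-diff∈rootsA σ unsigned (pair≢ ij∈))

    module A = Family σ (pairs n) diff (oddInversion σ) ρ-diff diff-counted

    theorem : L≡ (ΦA n) (ΔA n) σ (oinv σ)
    theorem = HasCard-⇔ (λ α → mk⇔ A.selected⇒counted classify) (HasCard-selected (pairs-unique n) diff-injective (oddInversion σ))
      where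
      classify : ∀ {α} → LPred (ΦA n) (ΔA n) σ α → Selected (pairs n) diff (oddInversion σ) α
      classify counted = A.counted⇒selected (rootsA-signed (proj₁ (proj₁ counted))) counted

-- Type B: Φ = {±(e_i ± e_j)} ∪ {±e_i}, Δ = steps ∪ {e_1}, height form e_m ↦ m.
unitsB : (n : ℕ) → List (V n)
unitsB n = concatMap (λ i → pm (e i)) (allFin n)

ΔB-steps : ∀ {n} → HasSteps (ΔB n)
ΔB-steps {suc k} i j j≡1+i = ∈P.∈-++⁺ˡ (ΔA-steps i j j≡1+i)

ρ-ΔB : ∀ {n} {β : V n} → β ∈ ΔB n → + 0 ℤ.≤ ⟪ ρ , β ⟫
ρ-ΔB {suc k} β∈ with ∈P.∈-++⁻ (ΔA (suc k)) β∈
... | inj₁ β∈A = ρ-ΔA β∈A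
... | inj₂ (here refl) = ℤP.<⇒≤ (ρ-e (Fin.zero {k}))

ht-ΔB : ∀ {n} {β : V n} → β ∈ ΔB n → ⟪ aff 1 1 , β ⟫ ≡ + 1
ht-ΔB {suc k} β∈ with ∈P.∈-++⁻ (ΔA (suc k)) β∈
... | inj₁ β∈A = aff-ΔA 1 1 β∈A
... | inj₂ (here refl) = ⟪⟫-e (aff 1 1) (Fin.zero {k})

-- e_m = (e_m − e_1) + e_1 lies in the cone of Δ_B.
unit-coneB : ∀ {n} (m : Fin n) → Cone (ΔB n) (e m)
unit-coneB {suc k} m = subst (Cone (ΔB (suc k))) (⊖-⊕-cancel (e m) (e Fin.zero))
  (cone-⊕ (ΔB (suc k)) (cone-diff (ΔB (suc k)) ΔB-steps Fin.zero m z≤n) (cone-∈ (ΔB (suc k)) (∈P.∈-++⁺ʳ (ΔA (suc k)) (here refl))))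

E∈units : ∀ {n} (b : Bool) (p : Fin n) → E b p ∈ unitsB n
E∈units true p = ∈-∓⁺ e (∈P.∈-allFin p)
E∈units false p = ∈-±⁺ e (∈P.∈-allFin p)

-- L(σ) counts the units e_i of odd height i with σ(i) < 0, the odd inversions,
-- and the sums e_i + e_j of odd height i + j (j − i odd) with σ(i) + σ(j) < 0.
module TypeB (n : ℕ) where

  unit-positive : ∀ {i} → i ∈ allFin n → Cone (ΔB n) (e i) × + 0 ℤ.< ⟪ ρ , e i ⟫
  unit-positive {i} _ = unit-coneB i , ρ-e i

  plus-positive : ∀ {x} → x ∈ pairs n → Cone (ΔB n) (plus x) × + 0 ℤ.< ⟪ ρ , plus x ⟫
  plus-positive {i , j} _ = cone-⊕ (ΔB n) (unit-coneB i) (unit-coneB j) , ρ-plus (i , j)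

  split : ∀ {γ} → γ ∈ ΦB n → (Cone (ΔB n) γ × + 0 ℤ.< ⟪ ρ , γ ⟫) ⊎ ⟪ ρ , γ ⟫ ℤ.< + 0
  split γ∈ with ∈-++₃⁻ (rootsA n) (rootsPlus n) γ∈
  ... | inj₁ γ∈A = signed-split (ΔB n) (diff-positive ΔB-steps) (rootsA-signed γ∈A)
  ... | inj₂ (inj₁ γ∈P) = signed-split (ΔB n) plus-positive (rootsPlus-signed γ∈P)
  ... | inj₂ (inj₂ γ∈U) = signed-split (ΔB n) unit-positive (∈-±⁻ e (allFin n) γ∈U)

  negClosed : NegClosed (ΦB n)
  negClosed = ++-negClosed (±-negClosed _ (pairs n)) (++-negClosed (±-negClosed plus (pairs n)) (±-negClosed e (allFin n)))

  open RootData (ΦB n) (ΔB n) ρ-ΔB split negClosed 0 1 ht-ΔB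

  module Count (σ : SignedPerm n) where

    diff-counted : ∀ {x} → x ∈ pairs n → LPred (ΦB n) (ΔB n) σ (diff x) ⇔ T (oddInversion σ x)
    diff-counted {i , j} ij∈ =
      diff-criterion σ ij∈ (ΦD⊆ (unitsB n) (∈P.∈-++⁺ˡ (diff∈rootsA ij∈)) , proj₁ (diff-positive ΔB-steps ij∈))
        (ΦD⊆ (unitsB n) (act-diff∈ΦD σ (pair≢ ij∈)))

    plus-counted : ∀ {x} → x ∈ pairs n → LPred (ΦB n) (ΔB n) σ (plus x) ⇔ T (oddNegativeSum σ x)
    plus-counted {i , j} ij∈ =
      plus-criterion σ {N = suc (suc (toℕ i ℕ.+ toℕ j))}
        (ΦD⊆ (unitsB n) (∈P.∈-++⁺ʳ (rootsA n) (∈-±⁺ plus ij∈)) , proj₁ (plus-positive ij∈))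
        (ΦD⊆ (unitsB n) (act-plus∈ΦD σ (pair≢ ij∈))) height
        (⇔.trans (≡-⇔ (parity-+ (ℕP.<⇒≤ (∈-pairs⁻ ij∈)))) (⇔.sym (T-odd (toℕ j ∸ toℕ i))))
      where
      height : ⟪ aff 1 1 , plus (i , j) ⟫ ≡ + 1 * + suc (suc (toℕ i ℕ.+ toℕ j))
      height = trans (⟪⟫-⊕ (aff 1 1) (e i) (e j))
        (trans (cong₂ _+_ (⟪⟫-e (aff 1 1) i) (⟪⟫-e (aff 1 1) j)) (trans (cong +_ (ring (toℕ i) (toℕ j))) (sym (ℤP.*-identityˡ _))))
        where ring : ∀ a b → (1 ℕ.* a ℕ.+ 1) ℕ.+ (1 ℕ.* b ℕ.+ 1) ≡ suc (suc (a ℕ.+ b))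
              ring = ℕ-Solver.solve-∀

    unit-counted : ∀ {i} → i ∈ allFin n → LPred (ΦB n) (ΔB n) σ (e i) ⇔ T (oddNegative σ i)
    unit-counted {i} _ =
      counted⇔T σ {N = suc (toℕ i)} (∈-++₃⁺ʳ (rootsA n) (rootsPlus n) (∈-±⁺ e (∈P.∈-allFin i)) , unit-coneB i) height
        (∈-++₃⁺ʳ (rootsA n) (rootsPlus n) (subst (_∈ unitsB n) (sym (act-e σ i)) (E∈units (neg σ i) (perm σ i))))
        (negative-via (ρ-act-e σ i) (⇔.sym (T-does (window σ i <? + 0))))
        (⇔.trans (suc-odd⇔even (toℕ i)) (⇔.sym (T-even (toℕ i))))
      where
      height : ⟪ aff 1 1 , e i ⟫ ≡ + 1 * + suc (toℕ i)
      height = trans (⟪⟫-e (aff 1 1) i) (trans (cong +_ (ring (toℕ i))) (sym (ℤP.*-identityˡ _)))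
        where ring : ∀ a → 1 ℕ.* a ℕ.+ 1 ≡ suc a
              ring = ℕ-Solver.solve-∀

    module U = Family σ (allFin n) e (oddNegative σ) (λ {i} _ → ρ-e i) unit-counted
    module A = Family σ (pairs n) diff (oddInversion σ) ρ-diff diff-counted
    module P = Family σ (pairs n) plus (oddNegativeSum σ) (λ {x} _ → ρ-plus x) plus-counted

    decomposition : ∀ α → LPred (ΦB n) (ΔB n) σ α ⇔
               ((Selected (allFin n) e (oddNegative σ) α ⊎ Selected (pairs n) diff (oddInversion σ) α)
                 ⊎ Selected (pairs n) plus (oddNegativeSum σ) α)
    decomposition α = mk⇔ classify [ [ U.selected⇒counted , A.selected⇒counted ] , P.selected⇒counted ]
      where
      classify : LPred (ΦB n) (ΔB n) σ α → _
      classify counted with ∈-++₃⁻ (rootsA n) (rootsPlus n) (proj₁ (proj₁ counted))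
      ... | inj₁ α∈A = inj₁ (inj₂ (A.counted⇒selected (rootsA-signed α∈A) counted))
      ... | inj₂ (inj₁ α∈P) = inj₂ (P.counted⇒selected (rootsPlus-signed α∈P) counted)
      ... | inj₂ (inj₂ α∈U) = inj₁ (inj₁ (U.counted⇒selected (∈-±⁻ e (allFin n) α∈U) counted))

    -- The families are disjoint (coordinate sums 1, 0, 2), so the counts add up.
    theorem : L≡ (ΦB n) (ΔB n) σ (oneg σ ℕ.+ oinv σ ℕ.+ onsp σ)
    theorem = HasCard-⇔ (λ α → ⇔.sym (decomposition α))
      (HasCard-⊎ (HasCard-⊎ (HasCard-selected (UniqueP.allFin⁺ n) (λ _ _ → e-injective) (oddNegative σ))
                            (HasCard-selected (pairs-unique n) diff-injective (oddInversion σ))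
                            (apart 𝟙 (⟪⟫-e 𝟙) 𝟙-diff λ ()))
                 (HasCard-selected (pairs-unique n) plus-injective (oddNegativeSum σ))
                 [ apart 𝟙 (⟪⟫-e 𝟙) 𝟙-plus (λ ()) , apart 𝟙 𝟙-diff 𝟙-plus (λ ()) ])

-- Type C: Φ = {±(e_i ± e_j)} ∪ {±2e_i}, Δ = steps ∪ {2e_1}, height form e_m ↦ 2m − 1.
doublesC : (n : ℕ) → List (V n)
doublesC n = concatMap (λ i → pm (double i)) (allFin n)

ΔC-steps : ∀ {n} → HasSteps (ΔC n)
ΔC-steps {suc k} i j j≡1+i = ∈P.∈-++⁺ˡ (ΔA-steps i j j≡1+i)

ρ-ΔC : ∀ {n} {β : V n} → β ∈ ΔC n → + 0 ℤ.≤ ⟪ ρ , β ⟫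
ρ-ΔC {suc k} β∈ with ∈P.∈-++⁻ (ΔA (suc k)) β∈
... | inj₁ β∈A = ρ-ΔA β∈A
... | inj₂ (here refl) = ℤP.<⇒≤ (ρ-double (Fin.zero {k}))

ht-ΔC : ∀ {n} {β : V n} → β ∈ ΔC n → ⟪ aff 2 1 , β ⟫ ≡ + 2
ht-ΔC {suc k} β∈ with ∈P.∈-++⁻ (ΔA (suc k)) β∈
... | inj₁ β∈A = aff-ΔA 2 1 β∈A
... | inj₂ (here refl) = trans (⟪⟫-scale (aff 2 1) (+ 2) (e (Fin.zero {k}))) (cong (+ 2 *_) (⟪⟫-e (aff 2 1) (Fin.zero {k})))

-- 2e_m = 2(e_m − e_1) + 2e_1 and e_i + e_j = (e_j − e_i) + 2e_i lie in the cone of Δ_C.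
double-coneC : ∀ {n} (m : Fin n) → Cone (ΔC n) (double m)
double-coneC {suc k} m = subst (Cone (ΔC (suc k))) (identity (e m) (e Fin.zero))
  (cone-⊕ (ΔC (suc k)) step (cone-⊕ (ΔC (suc k)) step (cone-∈ (ΔC (suc k)) (∈P.∈-++⁺ʳ (ΔA (suc k)) (here refl)))))
  where
  step = cone-diff (ΔC (suc k)) ΔC-steps Fin.zero m z≤n
  identity : ∀ {n} (a b : V n) → (a ⊖ b) ⊕ ((a ⊖ b) ⊕ scale (+ 2) b) ≡ scale (+ 2) a
  identity [] [] = refl
  identity (x ∷ a) (y ∷ b) = cong₂ _∷_ (ring x y) (identity a b)
    where ring : ∀ x y → (x - y) + ((x - y) + + 2 * y) ≡ + 2 * x
          ring = solve-∀

plus-coneC : ∀ {n} {x : Fin n × Fin n} → x ∈ pairs n → Cone (ΔC n) (plus x)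
plus-coneC {n} {i , j} ij∈ = subst (Cone (ΔC n)) (identity (e i) (e j))
  (cone-⊕ (ΔC n) (cone-diff (ΔC n) ΔC-steps i j (ℕP.<⇒≤ (∈-pairs⁻ ij∈))) (double-coneC i))
  where
  identity : ∀ {n} (a b : V n) → (b ⊖ a) ⊕ scale (+ 2) a ≡ a ⊕ b
  identity [] [] = refl
  identity (x ∷ a) (y ∷ b) = cong₂ _∷_ (ring x y) (identity a b)
    where ring : ∀ x y → (y - x) + + 2 * x ≡ x + y
          ring = solve-∀

act-double∈ : ∀ {n} (σ : SignedPerm n) (i : Fin n) → act σ (double i) ∈ doublesC n
act-double∈ σ i rewrite act-scale σ (+ 2) (e i) | act-e σ i = signed (neg σ i)
  where
  signed : ∀ b → scale (+ 2) (E b (perm σ i)) ∈ doublesC _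
  signed true = subst (_∈ doublesC _) (sym (scale-negV (+ 2) (e (perm σ i)))) (∈-∓⁺ double (∈P.∈-allFin (perm σ i)))
  signed false = ∈-±⁺ double (∈P.∈-allFin (perm σ i))

-- L(σ) counts the doubles 2e_i with σ(i) < 0 (their height 2i − 1 is odd), the
-- odd inversions, and the sums e_i + e_j of height i + j − 1, odd iff j − i is
-- even, with σ(i) + σ(j) < 0.
module TypeC (n : ℕ) where

  double-positive : ∀ {i} → i ∈ allFin n → Cone (ΔC n) (double i) × + 0 ℤ.< ⟪ ρ , double i ⟫
  double-positive {i} _ = double-coneC i , ρ-double i

  plus-positive : ∀ {x} → x ∈ pairs n → Cone (ΔC n) (plus x) × + 0 ℤ.< ⟪ ρ , plus x ⟫
  plus-positive {x} x∈ = plus-coneC x∈ , ρ-plus x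

  split : ∀ {γ} → γ ∈ ΦC n → (Cone (ΔC n) γ × + 0 ℤ.< ⟪ ρ , γ ⟫) ⊎ ⟪ ρ , γ ⟫ ℤ.< + 0
  split γ∈ with ∈-++₃⁻ (rootsA n) (rootsPlus n) γ∈
  ... | inj₁ γ∈A = signed-split (ΔC n) (diff-positive ΔC-steps) (rootsA-signed γ∈A)
  ... | inj₂ (inj₁ γ∈P) = signed-split (ΔC n) plus-positive (rootsPlus-signed γ∈P)
  ... | inj₂ (inj₂ γ∈D) = signed-split (ΔC n) double-positive (∈-±⁻ double (allFin n) γ∈D)

  negClosed : NegClosed (ΦC n)
  negClosed = ++-negClosed (±-negClosed _ (pairs n)) (++-negClosed (±-negClosed plus (pairs n)) (±-negClosed double (allFin n)))

  open RootData (ΦC n) (ΔC n) ρ-ΔC split negClosed 1 1 ht-ΔC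

  module Count (σ : SignedPerm n) where

    diff-counted : ∀ {x} → x ∈ pairs n → LPred (ΦC n) (ΔC n) σ (diff x) ⇔ T (oddInversion σ x)
    diff-counted {i , j} ij∈ =
      diff-criterion σ ij∈ (ΦD⊆ (doublesC n) (∈P.∈-++⁺ˡ (diff∈rootsA ij∈)) , proj₁ (diff-positive ΔC-steps ij∈))
        (ΦD⊆ (doublesC n) (act-diff∈ΦD σ (pair≢ ij∈)))

    plus-counted : ∀ {x} → x ∈ pairs n → LPred (ΦC n) (ΔC n) σ (plus x) ⇔ T (evenNegativeSum σ x)
    plus-counted {i , j} ij∈ =
      plus-criterion σ {N = suc (toℕ i ℕ.+ toℕ j)}
        (ΦD⊆ (doublesC n) (∈P.∈-++⁺ʳ (rootsA n) (∈-±⁺ plus ij∈)) , plus-coneC ij∈)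
        (ΦD⊆ (doublesC n) (act-plus∈ΦD σ (pair≢ ij∈))) height
        (⇔.trans (suc-odd⇔even (toℕ i ℕ.+ toℕ j))
          (⇔.trans (≡-⇔ (parity-+ (ℕP.<⇒≤ (∈-pairs⁻ ij∈)))) (⇔.sym (T-even (toℕ j ∸ toℕ i)))))
      where
      height : ⟪ aff 2 1 , plus (i , j) ⟫ ≡ + 2 * + suc (toℕ i ℕ.+ toℕ j)
      height = trans (⟪⟫-⊕ (aff 2 1) (e i) (e j))
        (trans (cong₂ _+_ (⟪⟫-e (aff 2 1) i) (⟪⟫-e (aff 2 1) j))
               (trans (cong +_ (ring (toℕ i) (toℕ j))) (ℤP.pos-* 2 (suc (toℕ i ℕ.+ toℕ j)))))
        where ring : ∀ a b → (2 ℕ.* a ℕ.+ 1) ℕ.+ (2 ℕ.* b ℕ.+ 1) ≡ 2 ℕ.* suc (a ℕ.+ b)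
              ring = ℕ-Solver.solve-∀

    -- 2e_i has odd height 2i + 1, so it is counted iff σ(i) < 0.
    double-counted : ∀ {i} → i ∈ allFin n → LPred (ΦC n) (ΔC n) σ (double i) ⇔ T (negative σ i)
    double-counted {i} _ =
      ⇔.trans (counted⇔ σ {N = 1 ℕ.+ toℕ i ℕ.* 2}
                 (∈-++₃⁺ʳ (rootsA n) (rootsPlus n) (∈-±⁺ double (∈P.∈-allFin i)) , double-coneC i)
                 height (∈-++₃⁺ʳ (rootsA n) (rootsPlus n) (act-double∈ σ i)))
        (⇔.trans (mk⇔ proj₁ (_, [m+kn]%n≡m%n 1 (toℕ i) 2))
          (negative-via (ρ-act-double σ i) (⇔.trans (2*<0⇔<0 (window σ i)) (⇔.sym (T-does (window σ i <? + 0))))))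
      where
      height : ⟪ aff 2 1 , double i ⟫ ≡ + 2 * + (1 ℕ.+ toℕ i ℕ.* 2)
      height = trans (⟪⟫-scale (aff 2 1) (+ 2) (e i)) (cong (+ 2 *_) (trans (⟪⟫-e (aff 2 1) i) (cong +_ (ring (toℕ i)))))
        where ring : ∀ a → 2 ℕ.* a ℕ.+ 1 ≡ 1 ℕ.+ a ℕ.* 2
              ring = ℕ-Solver.solve-∀

    module S = Family σ (allFin n) double (negative σ) (λ {i} _ → ρ-double i) double-counted
    module A = Family σ (pairs n) diff (oddInversion σ) ρ-diff diff-counted
    module P = Family σ (pairs n) plus (evenNegativeSum σ) (λ {x} _ → ρ-plus x) plus-counted

    decomposition : ∀ α → LPred (ΦC n) (ΔC n) σ α ⇔
                    ((Selected (allFin n) double (negative σ) α ⊎ Selected (pairs n) diff (oddInversion σ) α)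
                      ⊎ Selected (pairs n) plus (evenNegativeSum σ) α)
    decomposition α = mk⇔ classify [ [ S.selected⇒counted , A.selected⇒counted ] , P.selected⇒counted ]
      where
      classify : LPred (ΦC n) (ΔC n) σ α → _
      classify counted with ∈-++₃⁻ (rootsA n) (rootsPlus n) (proj₁ (proj₁ counted))
      ... | inj₁ α∈A = inj₁ (inj₂ (A.counted⇒selected (rootsA-signed α∈A) counted))
      ... | inj₂ (inj₁ α∈P) = inj₂ (P.counted⇒selected (rootsPlus-signed α∈P) counted)
      ... | inj₂ (inj₂ α∈D) = inj₁ (inj₁ (S.counted⇒selected (∈-±⁻ double (allFin n) α∈D) counted))

    -- The families are disjoint (coordinate sums and coordinate parity), so the counts add up.
    theorem : L≡ (ΦC n) (ΔC n) σ (nneg σ ℕ.+ oinv σ ℕ.+ ensp σ)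
    theorem = HasCard-⇔ (λ α → ⇔.sym (decomposition α))
      (HasCard-⊎ (HasCard-⊎ (HasCard-selected (UniqueP.allFin⁺ n) (λ _ _ → double-injective) (negative σ))
                            (HasCard-selected (pairs-unique n) diff-injective (oddInversion σ))
                            (apart 𝟙 𝟙-double 𝟙-diff λ ()))
                 (HasCard-selected (pairs-unique n) plus-injective (evenNegativeSum σ))
                 [ double-apart-plus , apart 𝟙 𝟙-diff 𝟙-plus (λ ()) ])
      where
      double-apart-plus : ∀ {α} → Selected (allFin n) double (negative σ) α → Selected (pairs n) plus (evenNegativeSum σ) α → ⊥
      double-apart-plus (selected m _ refl _) (selected x x∈ α≡ _) = plus≢double {m = m} x∈ (sym α≡)

-- Type D: Φ = {±(e_i ± e_j)}, Δ = steps ∪ {e_1 + e_2}, height form e_m ↦ m − 1.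
ΔD-steps : ∀ {n} → HasSteps (ΔD n)
ΔD-steps {suc zero} Fin.zero Fin.zero ()
ΔD-steps {suc (suc k)} i j j≡1+i = ∈P.∈-++⁺ˡ (ΔA-steps i j j≡1+i)

ρ-ΔD : ∀ {n} {β : V n} → β ∈ ΔD n → + 0 ℤ.≤ ⟪ ρ , β ⟫
ρ-ΔD {suc (suc k)} β∈ with ∈P.∈-++⁻ (ΔA (suc (suc k))) β∈
... | inj₁ β∈A = ρ-ΔA β∈A
... | inj₂ (here refl) = ℤP.<⇒≤ (ρ-plus (Fin.zero , Fin.suc (Fin.zero {k})))

ht-ΔD : ∀ {n} {β : V n} → β ∈ ΔD n → ⟪ aff 1 0 , β ⟫ ≡ + 1
ht-ΔD {suc (suc k)} β∈ with ∈P.∈-++⁻ (ΔA (suc (suc k))) β∈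
... | inj₁ β∈A = aff-ΔA 1 0 β∈A
... | inj₂ (here refl) = trans (⟪⟫-⊕ (aff 1 0) (e z₀) (e z₁)) (cong₂ _+_ (⟪⟫-e (aff 1 0) z₀) (⟪⟫-e (aff 1 0) z₁))
  where z₀ = Fin.zero {suc k}
        z₁ = Fin.suc (Fin.zero {k})

-- e_i + e_j = (e_1 + e_2) + (e_i − e_1) + (e_j − e_2) lies in the cone of Δ_D when i < j.
plus-coneD : ∀ {n} {x : Fin n × Fin n} → x ∈ pairs n → Cone (ΔD n) (plus x)
plus-coneD {n} {i , j} ij∈ with ∈-pairs⁻ ij∈
plus-coneD {suc (suc k)} {i , j} ij∈ | i<j = subst (Cone Δ) (identity (e Fin.zero) (e z₁) (e i) (e j))
  (cone-⊕ Δ (cone-∈ Δ (∈P.∈-++⁺ʳ (ΔA (suc (suc k))) (here refl)))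
            (cone-⊕ Δ (cone-diff Δ ΔD-steps Fin.zero i z≤n) (cone-diff Δ ΔD-steps z₁ j (ℕP.≤-trans (s≤s z≤n) i<j))))
  where
  Δ = ΔD (suc (suc k))
  z₁ = Fin.suc (Fin.zero {k})
  identity : ∀ {n} (a b c d : V n) → (a ⊕ b) ⊕ ((c ⊖ a) ⊕ (d ⊖ b)) ≡ c ⊕ d
  identity [] [] [] [] = refl
  identity (a ∷ as) (b ∷ bs) (c ∷ cs) (d ∷ ds) = cong₂ _∷_ (ring a b c d) (identity as bs cs ds)
    where ring : ∀ a b c d → (a + b) + ((c - a) + (d - b)) ≡ c + d
          ring = solve-∀
plus-coneD {suc zero} {Fin.zero , Fin.zero} ij∈ | ()

-- L(σ) counts the odd inversions and the sums e_i + e_j of height i + j − 2, odd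
-- iff j − i is odd, with σ(i) + σ(j) < 0.  Every signed permutation preserves Φ_D.
module TypeD (n : ℕ) where

  plus-positive : ∀ {x} → x ∈ pairs n → Cone (ΔD n) (plus x) × + 0 ℤ.< ⟪ ρ , plus x ⟫
  plus-positive {x} x∈ = plus-coneD x∈ , ρ-plus x

  split : ∀ {γ} → γ ∈ ΦD n → (Cone (ΔD n) γ × + 0 ℤ.< ⟪ ρ , γ ⟫) ⊎ ⟪ ρ , γ ⟫ ℤ.< + 0
  split γ∈ with ∈P.∈-++⁻ (rootsA n) γ∈
  ... | inj₁ γ∈A = signed-split (ΔD n) (diff-positive ΔD-steps) (rootsA-signed γ∈A)
  ... | inj₂ γ∈P = signed-split (ΔD n) plus-positive (rootsPlus-signed γ∈P)

  negClosed : NegClosed (ΦD n)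
  negClosed = ++-negClosed (±-negClosed _ (pairs n)) (±-negClosed plus (pairs n))

  open RootData (ΦD n) (ΔD n) ρ-ΔD split negClosed 0 0 ht-ΔD

  module Count (σ : SignedPerm n) where

    diff-counted : ∀ {x} → x ∈ pairs n → LPred (ΦD n) (ΔD n) σ (diff x) ⇔ T (oddInversion σ x)
    diff-counted {i , j} ij∈ =
      diff-criterion σ ij∈ (∈P.∈-++⁺ˡ (diff∈rootsA ij∈) , proj₁ (diff-positive ΔD-steps ij∈)) (act-diff∈ΦD σ (pair≢ ij∈))

    plus-counted : ∀ {x} → x ∈ pairs n → LPred (ΦD n) (ΔD n) σ (plus x) ⇔ T (oddNegativeSum σ x)
    plus-counted {i , j} ij∈ =
      plus-criterion σ {N = toℕ i ℕ.+ toℕ j} (∈P.∈-++⁺ʳ (rootsA n) (∈-±⁺ plus ij∈) , plus-coneD ij∈)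
        (act-plus∈ΦD σ (pair≢ ij∈)) height
        (⇔.trans (≡-⇔ (parity-+ (ℕP.<⇒≤ (∈-pairs⁻ ij∈)))) (⇔.sym (T-odd (toℕ j ∸ toℕ i))))
      where
      height : ⟪ aff 1 0 , plus (i , j) ⟫ ≡ + 1 * + (toℕ i ℕ.+ toℕ j)
      height = trans (⟪⟫-⊕ (aff 1 0) (e i) (e j))
        (trans (cong₂ _+_ (⟪⟫-e (aff 1 0) i) (⟪⟫-e (aff 1 0) j)) (trans (cong +_ (ring (toℕ i) (toℕ j))) (sym (ℤP.*-identityˡ _))))
        where ring : ∀ a b → (1 ℕ.* a ℕ.+ 0) ℕ.+ (1 ℕ.* b ℕ.+ 0) ≡ a ℕ.+ b
              ring = ℕ-Solver.solve-∀

    module A = Family σ (pairs n) diff (oddInversion σ) ρ-diff diff-counted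
    module P = Family σ (pairs n) plus (oddNegativeSum σ) (λ {x} _ → ρ-plus x) plus-counted

    decomposition : ∀ α → LPred (ΦD n) (ΔD n) σ α ⇔
                    (Selected (pairs n) diff (oddInversion σ) α ⊎ Selected (pairs n) plus (oddNegativeSum σ) α)
    decomposition α = mk⇔ classify [ A.selected⇒counted , P.selected⇒counted ]
      where
      classify : LPred (ΦD n) (ΔD n) σ α → _
      classify counted with ∈P.∈-++⁻ (rootsA n) (proj₁ (proj₁ counted))
      ... | inj₁ α∈A = inj₁ (A.counted⇒selected (rootsA-signed α∈A) counted)
      ... | inj₂ α∈P = inj₂ (P.counted⇒selected (rootsPlus-signed α∈P) counted)

    -- The families are disjoint (coordinate sums 0, 2), so the counts add up.
    theorem : L≡ (ΦD n) (ΔD n) σ (oinv σ ℕ.+ onsp σ)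
    theorem = HasCard-⇔ (λ α → ⇔.sym (decomposition α))
      (HasCard-⊎ (HasCard-selected (pairs-unique n) diff-injective (oddInversion σ))
                 (HasCard-selected (pairs-unique n) plus-injective (oddNegativeSum σ))
                 (apart 𝟙 𝟙-diff 𝟙-plus (λ ())))

-- The theorem: each type is handled by its Count module.  The argument works for
-- every n.
mainTheorem2 : (n : ℕ) → 1 ℕ.≤ n →
    ((σ : SignedPerm n) → InS σ → L≡ (ΦA n) (ΔA n) σ (oinv σ))
    × ((σ : SignedPerm n) → L≡ (ΦB n) (ΔB n) σ (oneg σ ℕ.+ oinv σ ℕ.+ onsp σ))
    × ((σ : SignedPerm n) → L≡ (ΦC n) (ΔC n) σ (nneg σ ℕ.+ oinv σ ℕ.+ ensp σ))
    × ((σ : SignedPerm n) → InD σ → L≡ (ΦD n) (ΔD n) σ (oinv σ ℕ.+ onsp σ))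
mainTheorem2 n _ =
  (λ σ unsigned → TypeA.Count.theorem n σ unsigned) ,
  (λ σ → TypeB.Count.theorem n σ) ,
  (λ σ → TypeC.Count.theorem n σ) ,
  (λ σ _ → TypeD.Count.theorem n σ)
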